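{- For every integer $k\ge 0$, \[ \ell(k) = \frac{j(k)}{4} + \ell(k-2) - \frac{\ell(k-4)}{4}, \] where $\ell(k) := \lim_{n\to\infty} P(2n-1-|S-S| = k)$ and $j(k) := \lim_{n\to\infty} P\big(2n-1-|S-S| = k \mid 0\in S,\ n-1\in S\big)$, with $S$ a uniformly random subset of $[n]$.
   Context: For a positive integer $n$, $[n] := \{0,1,\dots,n-1\}$, random subsets are uniform over all $2^n$ subsets, and $S-S := \{x-y : x,y\in S\}$. Both limits exist for every integer $k$; since $|S-S|\le 2n-1$, the probabilities, hence $\ell(k)$ and $j(k)$, are $0$ for negative $k$. -}

module Defs where

open import Data.Bool using (Bool; true; false; _∧_)
open import Data.Nat as ℕ using (ℕ; zero; suc; _∸_)
open import Data.Nat.Properties using (_<?_; m^n≢0)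
open import Data.Integer as ℤ using (ℤ; +_)
open import Data.List using (List; []; _∷_; map; filterᵇ; length; upTo; concatMap)
open import Data.Vec using (Vec; []; _∷_; lookup)
open import Data.Fin using (fromℕ<)
open import Data.Bool.ListAction using (any)
open import Data.Rational as ℚ using (ℚ; _/_; 0ℚ)
open import Relation.Nullary.Decidable using (⌊_⌋)
open import Relation.Nullary using (yes; no)

-- all 2^n subsets of [n] = {0,..,n-1}, as characteristic vectors
allSubsets : (n : ℕ) → List (Vec Bool n)
allSubsets zero = [] ∷ []
allSubsets (suc n) = concatMap (λ v → (false ∷ v) ∷ (true ∷ v) ∷ []) (allSubsets n)

mem : {n : ℕ} → Vec Bool n → ℕ → Bool
mem {n} S x with x <? n
... | yes x<n = lookup S (fromℕ< x<n)
... | no _ = false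

inDiff : {n : ℕ} → Vec Bool n → ℤ → Bool
inDiff {n} S d =
  any (λ x → any (λ y → mem S x ∧ mem S y ∧ ⌊ ((+ x) ℤ.- (+ y)) ℤ.≟ d ⌋) (upTo n)) (upTo n)

-- |S - S| : number of integers d ∈ S - S (all such d lie in [-n, n])
diffSize : {n : ℕ} → Vec Bool n → ℕ
diffSize {n} S = length (filterᵇ (inDiff S) (map (λ i → (+ i) ℤ.- (+ n)) (upTo (2 ℕ.* n ℕ.+ 1))))

event : {n : ℕ} → ℤ → Vec Bool n → Bool
event {n} k S = ⌊ (((+ (2 ℕ.* n)) ℤ.- (+ 1)) ℤ.- (+ diffSize S)) ℤ.≟ k ⌋

ends : {n : ℕ} → Vec Bool n → Bool
ends {n} S = mem S 0 ∧ mem S (n ∸ 1)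

ellN : ℕ → ℤ → ℚ
ellN n k = (+ length (filterᵇ (event k) (allSubsets n))) / (2 ℕ.^ n)
  where instance _ = m^n≢0 2 n

-- jₙ(k) = P(2n-1-|S-S| = k | 0 ∈ S, n-1 ∈ S) (defined as 0 if the condition has probability 0)
jN : ℕ → ℤ → ℚ
jN n k with length (filterᵇ ends (allSubsets n))
... | zero = 0ℚ
... | suc c = (+ length (filterᵇ (λ S → ends S ∧ event k S) (allSubsets n))) / suc c

{-# OPTIONS --safe #-}

-- Let ℓ#ₙ(K) count the S ⊆ [n] with 2n − 1 − |S − S| = K, and j#ₙ(K) those among them containing 0 and n − 1.
-- Deleting an end point that is not in S shifts S without changing |S − S|, so splitting on the two end points
-- gives the exact identity  ℓ#ₙ₊₂(K) + ℓ#ₙ(K − 4) = 2 ℓ#ₙ₊₁(K − 2) + j#ₙ₊₂(K).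
-- If S ⊆ [n] realises every difference up to n − L − 1, inserting a point at position L keeps all these short
-- differences and lengthens each long one by one, so |S − S| grows by exactly 2 (provided the new set is again
-- of this kind); hence ℓ#ₙ₊₁(K) = 2 ℓ#ₙ(K) up to the number of sets missing a short difference.
-- A set missing d contains none of about (n − d)/2 disjoint pairs {x, x + d}, which happens with probability
-- (3/4)^((n − d)/2) ≤ (7/8)^(n − d); summing over d ≤ n − L − 1, the bad sets form a proportion O((7/8)ᴸ).
-- Combining the identity with three such couplings and dividing by 2ⁿ leaves an error that is small once L is
-- large and n ≥ 2L + 4.

module Submission where

open import Defs

open import Algebra.Properties.CommutativeSemigroup using (interchange)
open import Data.Bool using (Bool; true; false; _∧_; _∨_; not; T)
open import Data.Bool.Properties using (T-≡; T-∧; T-∨; ∧-identityʳ; ∧-comm)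
open import Data.Bool.ListAction using (any)
open import Data.Empty using (⊥-elim)
open import Data.Fin as Fin using (Fin; fromℕ; fromℕ<; toℕ)
open import Data.Fin.Properties using (fromℕ<-cong; toℕ-fromℕ; toℕ-fromℕ<)
open import Data.List using (List; []; _∷_; map; filterᵇ; length; upTo; applyUpTo; concatMap)
open import Data.List.Relation.Unary.Any.Properties using (any⁺; any⁻)
open import Data.List.Membership.Propositional using (lose; find)
open import Data.List.Membership.Propositional.Properties using (∈-upTo⁺; ∈-upTo⁻)
open import Data.Nat as ℕ using (ℕ; zero; suc; _+_; _*_; _∸_; _^_; _≤_; _<_; z≤n; s≤s; z<s; s<s; s≤s⁻¹; _<ᵇ_; NonZero; >-nonZero⁻¹)
open import Data.Nat.Properties
open import Data.Nat.DivMod using (_%_; m<n⇒m%n≡m; [m+n]%n≡m%n; %-distribˡ-+)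
open import Data.Nat.Induction using (<-rec)
open import Data.Nat.Tactic.RingSolver using (solve-∀)
open import Data.Integer as ℤ using (ℤ; -[1+_])
import Data.Integer.Properties as ℤP
import Data.Integer.Tactic.RingSolver as ZR
open import Data.Rational as ℚ using (ℚ; mkℚ; 0ℚ; toℚᵘ; ↥_; ↧_; ↧ₙ_)
import Data.Rational.Properties as ℚP
open import Data.Rational.Unnormalised as ℚᵘ using (ℚᵘ; mkℚᵘ; *≡*) renaming (_≃_ to _≃ᵘ_; _/_ to _/ᵘ_)
import Data.Rational.Unnormalised.Properties as ℚᵘP
import Data.Rational.Solver
open import Data.Product using (∃-syntax; _×_; _,_; proj₁; proj₂)
open import Data.Sum as Sum using (_⊎_; inj₁; inj₂)
open import Data.Vec using (Vec; []; _∷_; lookup; insertAt)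
open import Function using (_∘_; case_of_)
open import Function.Bundles using (Equivalence)
open import Relation.Binary.Definitions using (tri<; tri≈; tri>)
open import Relation.Binary.PropositionalEquality
open import Relation.Nullary using (yes; no; ¬_)
open import Relation.Nullary.Decidable using (⌊_⌋; toWitness; fromWitness)

private variable
  A B : Set
  a b c d e f n : ℕ

+-interchange : ∀ a b c d → (a + b) + (c + d) ≡ (a + c) + (b + d)
+-interchange = interchange +-commutativeSemigroup

T-ext : {a b : Bool} → (T a → T b) → (T b → T a) → a ≡ b
T-ext {false} {false} _   _   = refl
T-ext {false} {true}  _   b⇒a = ⊥-elim (b⇒a _)
T-ext {true}  {false} a⇒b _   = ⊥-elim (a⇒b _)
T-ext {true}  {true}  _   _   = refl

T-not⇒¬T : {b : Bool} → T (not b) → ¬ T b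
T-not⇒¬T {false} _ ()

T-not-∧ : (x : Bool) {y : Bool} → T (not (x ∧ y)) → T (not x ∨ not y)
T-not-∧ false _ = _
T-not-∧ true  t = t

any-upTo⁺ : (p : ℕ → Bool) {y : ℕ} → y < n → T (p y) → T (any p (upTo n))
any-upTo⁺ p y<n py = any⁺ p (lose (∈-upTo⁺ y<n) py)

any-upTo⁻ : (p : ℕ → Bool) → T (any p (upTo n)) → ∃[ y ] y < n × T (p y)
any-upTo⁻ {n} p t with y , y∈upTo , py ← find (any⁻ p (upTo n) t) = y , ∈-upTo⁻ y∈upTo , py

+[m+n]-+m≡+n : ∀ m n → ℤ.+ (m + n) ℤ.- ℤ.+ m ≡ ℤ.+ n
+[m+n]-+m≡+n m n = trans (cong (ℤ._- ℤ.+ m) (ℤP.pos-+ m n)) (group-law (ℤ.+ m) (ℤ.+ n))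
  where
  group-law : ∀ a b → (a ℤ.+ b) ℤ.- a ≡ b
  group-law = ZR.solve-∀

+m-+[m+n]≡-+n : ∀ m n → ℤ.+ m ℤ.- ℤ.+ (m + n) ≡ ℤ.- ℤ.+ n
+m-+[m+n]≡-+n m n = trans (cong (λ z → ℤ.+ m ℤ.- z) (ℤP.pos-+ m n)) (group-law (ℤ.+ m) (ℤ.+ n))
  where
  group-law : ∀ a b → a ℤ.- (a ℤ.+ b) ≡ ℤ.- b
  group-law = ZR.solve-∀

+m-+n≡+d⇒m≡n+d : ∀ {m n d} → ℤ.+ m ℤ.- ℤ.+ n ≡ ℤ.+ d → m ≡ n + d
+m-+n≡+d⇒m≡n+d {m} {n} {d} eq = ℤP.+-injective (begin
  ℤ.+ m                          ≡⟨ group-law (ℤ.+ m) (ℤ.+ n) ⟩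
  ℤ.+ n ℤ.+ (ℤ.+ m ℤ.- ℤ.+ n)     ≡⟨ cong (λ z → ℤ.+ n ℤ.+ z) eq ⟩
  ℤ.+ n ℤ.+ ℤ.+ d                ≡⟨ ℤP.pos-+ n d ⟨
  ℤ.+ (n + d)                    ∎)
  where
  open ≡-Reasoning
  group-law : ∀ a b → a ≡ b ℤ.+ (a ℤ.- b)
  group-law = ZR.solve-∀

+m-+n≡-[1+d]⇒n≡m+1+d : ∀ {m n d} → ℤ.+ m ℤ.- ℤ.+ n ≡ -[1+ d ] → n ≡ m + suc d
+m-+n≡-[1+d]⇒n≡m+1+d {m} {n} eq = +m-+n≡+d⇒m≡n+d (trans (group-law (ℤ.+ m) (ℤ.+ n)) (cong ℤ.-_ eq))
  where
  group-law : ∀ a b → b ℤ.- a ≡ ℤ.- (a ℤ.- b)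
  group-law = ZR.solve-∀


-- Counting subsets

indicator : Bool → ℕ
indicator true  = 1
indicator false = 0

countᵇ : (A → Bool) → List A → ℕ
countᵇ p []       = 0
countᵇ p (x ∷ xs) = indicator (p x) + countᵇ p xs

length-filterᵇ : (p : A → Bool) (xs : List A) → length (filterᵇ p xs) ≡ countᵇ p xs
length-filterᵇ p []       = refl
length-filterᵇ p (x ∷ xs) with p x
... | true  = cong suc (length-filterᵇ p xs)
... | false = length-filterᵇ p xs

countᵇ-cong : {p q : A → Bool} → (∀ x → p x ≡ q x) → (xs : List A) → countᵇ p xs ≡ countᵇ q xs
countᵇ-cong eq []       = refl
countᵇ-cong eq (x ∷ xs) = cong₂ _+_ (cong indicator (eq x)) (countᵇ-cong eq xs)

countᵇ-map : (p : B → Bool) (f : A → B) (xs : List A) → countᵇ p (map f xs) ≡ countᵇ (p ∘ f) xs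
countᵇ-map p f []       = refl
countᵇ-map p f (x ∷ xs) = cong (indicator (p (f x)) +_) (countᵇ-map p f xs)

countᵇ-pairs : (p : B → Bool) (f g : A → B) (xs : List A) →
  countᵇ p (concatMap (λ x → f x ∷ g x ∷ []) xs) ≡ countᵇ (p ∘ f) xs + countᵇ (p ∘ g) xs
countᵇ-pairs p f g []       = refl
countᵇ-pairs p f g (x ∷ xs) = begin
  indicator (p (f x)) + (indicator (p (g x)) + countᵇ p (concatMap (λ x → f x ∷ g x ∷ []) xs))
    ≡⟨ cong (λ c → indicator (p (f x)) + (indicator (p (g x)) + c)) (countᵇ-pairs p f g xs) ⟩
  indicator (p (f x)) + (indicator (p (g x)) + (countᵇ (p ∘ f) xs + countᵇ (p ∘ g) xs))
    ≡⟨ sym (+-assoc (indicator (p (f x))) _ _) ⟩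
  (indicator (p (f x)) + indicator (p (g x))) + (countᵇ (p ∘ f) xs + countᵇ (p ∘ g) xs)
    ≡⟨ +-interchange (indicator (p (f x))) _ _ _ ⟩
  countᵇ (p ∘ f) (x ∷ xs) + countᵇ (p ∘ g) (x ∷ xs) ∎
  where open ≡-Reasoning

countᵇ-false : (xs : List A) → countᵇ (λ _ → false) xs ≡ 0
countᵇ-false []       = refl
countᵇ-false (x ∷ xs) = countᵇ-false xs

countᵇ-true : (xs : List A) → countᵇ (λ _ → true) xs ≡ length xs
countᵇ-true []       = refl
countᵇ-true (x ∷ xs) = cong suc (countᵇ-true xs)

countᵇ-complement : (p : A → Bool) (xs : List A) → countᵇ p xs + countᵇ (not ∘ p) xs ≡ length xs
countᵇ-complement p []       = refl
countᵇ-complement p (x ∷ xs) with p x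
... | true  = cong suc (countᵇ-complement p xs)
... | false = trans (+-suc _ _) (cong suc (countᵇ-complement p xs))

countᵇ-mono : {p q : A → Bool} → (∀ x → T (p x) → T (q x)) → (xs : List A) → countᵇ p xs ≤ countᵇ q xs
countᵇ-mono p⇒q []       = z≤n
countᵇ-mono {p = p} {q} p⇒q (x ∷ xs) = +-mono-≤ (indicator-mono (p x) (q x) (p⇒q x)) (countᵇ-mono p⇒q xs)
  where
  indicator-mono : (a b : Bool) → (T a → T b) → indicator a ≤ indicator b
  indicator-mono false b     _   = z≤n
  indicator-mono true  true  _   = ≤-refl
  indicator-mono true  false a⇒b = ⊥-elim (a⇒b _)

countᵇ-∨ : (p q : A → Bool) (xs : List A) → countᵇ (λ x → p x ∨ q x) xs ≤ countᵇ p xs + countᵇ q xs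
countᵇ-∨ p q []       = z≤n
countᵇ-∨ p q (x ∷ xs) = begin
  indicator (p x ∨ q x) + countᵇ (λ x → p x ∨ q x) xs
    ≤⟨ +-mono-≤ (indicator-∨ (p x) (q x)) (countᵇ-∨ p q xs) ⟩
  (indicator (p x) + indicator (q x)) + (countᵇ p xs + countᵇ q xs)
    ≡⟨ +-interchange (indicator (p x)) _ _ _ ⟩
  countᵇ p (x ∷ xs) + countᵇ q (x ∷ xs) ∎
  where
  open ≤-Reasoning
  indicator-∨ : (a b : Bool) → indicator (a ∨ b) ≤ indicator a + indicator b
  indicator-∨ false b = ≤-refl
  indicator-∨ true  b = s≤s z≤n

count : (n : ℕ) → (Vec Bool n → Bool) → ℕ
count n P = countᵇ P (allSubsets n)

count-∷ : (P : Vec Bool (suc n) → Bool) →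
  count (suc n) P ≡ count n (P ∘ (false ∷_)) + count n (P ∘ (true ∷_))
count-∷ {n} P = countᵇ-pairs P (false ∷_) (true ∷_) (allSubsets n)

count-cong : {P Q : Vec Bool n → Bool} → (∀ S → P S ≡ Q S) → count n P ≡ count n Q
count-cong {n} eq = countᵇ-cong eq (allSubsets n)

count-mono : {P Q : Vec Bool n → Bool} → (∀ S → T (P S) → T (Q S)) → count n P ≤ count n Q
count-mono {n} P⇒Q = countᵇ-mono P⇒Q (allSubsets n)

count-∨ : (P Q : Vec Bool n → Bool) → count n (λ S → P S ∨ Q S) ≤ count n P + count n Q
count-∨ {n} P Q = countᵇ-∨ P Q (allSubsets n)

count-false : (n : ℕ) → count n (λ _ → false) ≡ 0
count-false n = countᵇ-false (allSubsets n)

count-true : (n : ℕ) → count n (λ _ → true) ≡ 2 ^ n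
count-true zero    = refl
count-true (suc n) = trans (count-∷ {n} (λ _ → true)) (cong₂ _+_ (count-true n) (trans (count-true n) (sym (+-identityʳ _))))

count-complement : (P : Vec Bool n → Bool) → count n P + count n (not ∘ P) ≡ 2 ^ n
count-complement {n} P =
  trans (countᵇ-complement P (allSubsets n)) (trans (sym (countᵇ-true (allSubsets n))) (count-true n))

count-insertAt : (i : Fin (suc n)) (P : Vec Bool (suc n) → Bool) →
  count (suc n) P ≡ count n (λ S → P (insertAt S i false)) + count n (λ S → P (insertAt S i true))
count-insertAt Fin.zero P = count-∷ P
count-insertAt {suc n} (Fin.suc i) P = begin
  count (suc (suc n)) P
    ≡⟨ count-∷ P ⟩
  count (suc n) (P ∘ (false ∷_)) + count (suc n) (P ∘ (true ∷_))
    ≡⟨ cong₂ _+_ (count-insertAt i (P ∘ (false ∷_))) (count-insertAt i (P ∘ (true ∷_))) ⟩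
  (N false false + N false true) + (N true false + N true true)
    ≡⟨ +-interchange (N false false) (N false true) (N true false) (N true true) ⟩
  (N false false + N true false) + (N false true + N true true)
    ≡⟨ sym (cong₂ _+_ (count-∷ (P' false)) (count-∷ (P' true))) ⟩
  count (suc n) (P' false) + count (suc n) (P' true) ∎
  where
  open ≡-Reasoning
  N : Bool → Bool → ℕ
  N x b = count n (λ S → P (x ∷ insertAt S i b))
  P' : Bool → Vec Bool (suc n) → Bool
  P' b S = P (insertAt S (Fin.suc i) b)

sumBelow : (ℕ → ℕ) → ℕ → ℕ
sumBelow f zero    = 0
sumBelow f (suc m) = f 0 + sumBelow (f ∘ suc) m

countBelow : (ℕ → Bool) → ℕ → ℕ
countBelow p = sumBelow (indicator ∘ p)

sumBelow-cong : {f g : ℕ → ℕ} (m : ℕ) → (∀ i → i < m → f i ≡ g i) → sumBelow f m ≡ sumBelow g m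
sumBelow-cong zero    eq = refl
sumBelow-cong (suc m) eq = cong₂ _+_ (eq 0 z<s) (sumBelow-cong m (λ i i<m → eq (suc i) (s<s i<m)))

sumBelow-+ : (f : ℕ → ℕ) (a b : ℕ) → sumBelow f (a + b) ≡ sumBelow f a + sumBelow (λ i → f (a + i)) b
sumBelow-+ f zero    b = refl
sumBelow-+ f (suc a) b = trans (cong (f 0 +_) (sumBelow-+ (f ∘ suc) a b)) (sym (+-assoc (f 0) _ _))

sumBelow-last : (f : ℕ → ℕ) (m : ℕ) → sumBelow f (suc m) ≡ sumBelow f m + f m
sumBelow-last f zero    = +-identityʳ (f 0)
sumBelow-last f (suc m) = trans (cong (f 0 +_) (sumBelow-last (f ∘ suc) m)) (sym (+-assoc (f 0) _ _))

sumBelow-reverse : (f : ℕ → ℕ) (m : ℕ) → sumBelow (λ i → f (m ∸ suc i)) m ≡ sumBelow f m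
sumBelow-reverse f zero    = refl
sumBelow-reverse f (suc m) =
  trans (cong (f m +_) (sumBelow-reverse f m)) (trans (+-comm (f m) _) (sym (sumBelow-last f m)))

countBelow-true : (p : ℕ → Bool) (m : ℕ) → (∀ i → i < m → T (p i)) → countBelow p m ≡ m
countBelow-true p zero    all = refl
countBelow-true p (suc m) all with p 0 | all 0 z<s
... | true | _ = cong suc (countBelow-true (p ∘ suc) m (λ i i<m → all (suc i) (s<s i<m)))

countBelow-false : (p : ℕ → Bool) (m : ℕ) → (∀ i → i < m → ¬ T (p i)) → countBelow p m ≡ 0
countBelow-false p zero    none = refl
countBelow-false p (suc m) none with p 0 | none 0 z<s
... | false | _ = countBelow-false (p ∘ suc) m (λ i i<m → none (suc i) (s<s i<m))
... | true  | ¬⊤ = ⊥-elim (¬⊤ _)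

countᵇ-applyUpTo : (p : A → Bool) (f : ℕ → A) (m : ℕ) → countᵇ p (applyUpTo f m) ≡ countBelow (p ∘ f) m
countᵇ-applyUpTo p f zero    = refl
countᵇ-applyUpTo p f (suc m) = cong (indicator (p (f 0)) +_) (countᵇ-applyUpTo p (f ∘ suc) m)

allBelow : (ℕ → Bool) → ℕ → Bool
allBelow p zero    = true
allBelow p (suc m) = allBelow p m ∧ p m

allBelow⁺ : (p : ℕ → Bool) (m : ℕ) → (∀ i → i < m → T (p i)) → T (allBelow p m)
allBelow⁺ p zero    all = _
allBelow⁺ p (suc m) all = Equivalence.from T-∧ (allBelow⁺ p m (λ i i<m → all i (m<n⇒m<1+n i<m)) , all m ≤-refl)

allBelow⁻ : (p : ℕ → Bool) (m : ℕ) → T (allBelow p m) → ∀ i → i < m → T (p i)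
allBelow⁻ p (suc m) t i i<1+m with Equivalence.to T-∧ t | m<1+n⇒m<n∨m≡n i<1+m
... | t-m , _   | inj₁ i<m  = allBelow⁻ p m t-m i i<m
... | _   , t-p | inj₂ refl = t-p

allBelow-cong : {p q : ℕ → Bool} (m : ℕ) → (∀ i → i < m → p i ≡ q i) → allBelow p m ≡ allBelow q m
allBelow-cong zero    eq = refl
allBelow-cong (suc m) eq = cong₂ _∧_ (allBelow-cong m (λ i i<m → eq i (m<n⇒m<1+n i<m))) (eq m ≤-refl)

-- Differences

mem-< : (S : Vec Bool n) {x : ℕ} (x<n : x < n) → mem S x ≡ lookup S (fromℕ< x<n)
mem-< {n} S {x} x<n with x <? n
... | yes x<n′ = cong (lookup S) (fromℕ<-cong x x refl x<n′ x<n)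
... | no  x≮n  = ⊥-elim (x≮n x<n)

mem-≥ : (S : Vec Bool n) {x : ℕ} → n ≤ x → mem S x ≡ false
mem-≥ {n} S {x} n≤x with x <? n
... | yes x<n = ⊥-elim (<⇒≱ x<n n≤x)
... | no  _   = refl

mem⇒< : (S : Vec Bool n) {x : ℕ} → T (mem S x) → x < n
mem⇒< {n} S {x} x∈S with x <? n
... | yes x<n = x<n

mem-suc : (b : Bool) (S : Vec Bool n) (x : ℕ) → mem (b ∷ S) (suc x) ≡ mem S x
mem-suc {n} b S x with x <? n
... | yes x<n = mem-< (b ∷ S) (s<s x<n)
... | no  x≮n = mem-≥ (b ∷ S) (s≤s (≮⇒≥ x≮n))

mem-insertAt-< : (S : Vec Bool n) (i : Fin (suc n)) (b : Bool) {x : ℕ} →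
  x < toℕ i → mem (insertAt S i b) x ≡ mem S x
mem-insertAt-< (c ∷ S) (Fin.suc i) b {zero}  _         = refl
mem-insertAt-< (c ∷ S) (Fin.suc i) b {suc x} (s<s x<i) =
  trans (mem-suc c (insertAt S i b) x) (trans (mem-insertAt-< S i b x<i) (sym (mem-suc c S x)))

mem-insertAt-≡ : (S : Vec Bool n) (i : Fin (suc n)) (b : Bool) → mem (insertAt S i b) (toℕ i) ≡ b
mem-insertAt-≡ S       Fin.zero    b = refl
mem-insertAt-≡ (c ∷ S) (Fin.suc i) b = trans (mem-suc c (insertAt S i b) (toℕ i)) (mem-insertAt-≡ S i b)

mem-insertAt-> : (S : Vec Bool n) (i : Fin (suc n)) (b : Bool) {x : ℕ} →
  toℕ i ≤ x → mem (insertAt S i b) (suc x) ≡ mem S x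
mem-insertAt-> S       Fin.zero    b         _         = mem-suc b S _
mem-insertAt-> (c ∷ S) (Fin.suc i) b {suc x} (s≤s i≤x) =
  trans (mem-suc c (insertAt S i b) (suc x)) (trans (mem-insertAt-> S i b i≤x) (sym (mem-suc c S x)))

hasDiff : Vec Bool n → ℕ → Bool
hasDiff {n} S d = any (λ y → mem S y ∧ mem S (y + d)) (upTo n)

hasDiff⁺ : (S : Vec Bool n) {y d : ℕ} → T (mem S y) → T (mem S (y + d)) → T (hasDiff S d)
hasDiff⁺ S {d = d} y∈S y+d∈S =
  any-upTo⁺ (λ y → mem S y ∧ mem S (y + d)) (mem⇒< S y∈S) (Equivalence.from T-∧ (y∈S , y+d∈S))

hasDiff⁻ : (S : Vec Bool n) {d : ℕ} → T (hasDiff S d) → ∃[ y ] T (mem S y) × T (mem S (y + d))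
hasDiff⁻ {n} S {d} t with y , _ , y∈S∧y+d∈S ← any-upTo⁻ {n} (λ y → mem S y ∧ mem S (y + d)) t =
  y , Equivalence.to T-∧ y∈S∧y+d∈S

private
  differenceWitness : Vec Bool n → ℤ → ℕ → ℕ → Bool
  differenceWitness S d x y = mem S x ∧ mem S y ∧ ⌊ (ℤ.+ x ℤ.- ℤ.+ y) ℤ.≟ d ⌋

inDiff⁺ : (S : Vec Bool n) {d : ℤ} {x y : ℕ} →
  T (mem S x) → T (mem S y) → ℤ.+ x ℤ.- ℤ.+ y ≡ d → T (inDiff S d)
inDiff⁺ {n} S {d} {x} x∈S y∈S eq =
  any-upTo⁺ (λ x → any (differenceWitness S d x) (upTo n)) (mem⇒< S x∈S)
    (any-upTo⁺ (differenceWitness S d x) (mem⇒< S y∈S)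
      (Equivalence.from T-∧ (x∈S , Equivalence.from T-∧ (y∈S , fromWitness eq))))

inDiff⁻ : (S : Vec Bool n) {d : ℤ} → T (inDiff S d) →
  ∃[ x ] ∃[ y ] T (mem S x) × T (mem S y) × (ℤ.+ x ℤ.- ℤ.+ y ≡ d)
inDiff⁻ {n} S {d} t
  with x , _ , t′ ← any-upTo⁻ {n} (λ x → any (differenceWitness S d x) (upTo n)) t
  with y , _ , w ← any-upTo⁻ {n} (differenceWitness S d x) t′
  with x∈S , w′ ← Equivalence.to T-∧ w
  with y∈S , eq ← Equivalence.to T-∧ w′
  = x , y , x∈S , y∈S , toWitness eq

inDiff-+ : (S : Vec Bool n) (d : ℕ) → inDiff S (ℤ.+ d) ≡ hasDiff S d
inDiff-+ S d = T-ext
  (λ t → let x , y , x∈S , y∈S , eq = inDiff⁻ S t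
         in hasDiff⁺ S y∈S (subst (T ∘ mem S) (+m-+n≡+d⇒m≡n+d eq) x∈S))
  (λ t → let y , y∈S , y+d∈S = hasDiff⁻ S t
         in inDiff⁺ S y+d∈S y∈S (+[m+n]-+m≡+n y d))

inDiff-[1+] : (S : Vec Bool n) (d : ℕ) → inDiff S -[1+ d ] ≡ hasDiff S (suc d)
inDiff-[1+] S d = T-ext
  (λ t → let x , y , x∈S , y∈S , eq = inDiff⁻ S t
         in hasDiff⁺ S x∈S (subst (T ∘ mem S) (+m-+n≡-[1+d]⇒n≡m+1+d eq) y∈S))
  (λ t → let y , y∈S , y+d∈S = hasDiff⁻ S t
         in inDiff⁺ S y∈S y+d∈S (+m-+[m+n]≡-+n y (suc d)))

posDiffs : Vec Bool n → ℕ
posDiffs {n} S = countBelow (λ i → hasDiff S (suc i)) n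

diffSize-≡ : (S : Vec Bool n) → diffSize S ≡ indicator (hasDiff S 0) + (posDiffs S + posDiffs S)
diffSize-≡ {n} S = begin
  diffSize S
    ≡⟨ length-filterᵇ (inDiff S) (map shift (upTo (2 * n + 1))) ⟩
  countᵇ (inDiff S) (map shift (upTo (2 * n + 1)))
    ≡⟨ countᵇ-map (inDiff S) shift (upTo (2 * n + 1)) ⟩
  countᵇ (inDiff S ∘ shift) (upTo (2 * n + 1))
    ≡⟨ countᵇ-applyUpTo (inDiff S ∘ shift) (λ i → i) (2 * n + 1) ⟩
  countBelow (inDiff S ∘ shift) (2 * n + 1)
    ≡⟨ cong (countBelow (inDiff S ∘ shift)) (2m+1≡m+[1+m] n) ⟩
  countBelow (inDiff S ∘ shift) (n + suc n)
    ≡⟨ sumBelow-+ _ n (suc n) ⟩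
  countBelow (inDiff S ∘ shift) n + countBelow (λ i → inDiff S (shift (n + i))) (suc n)
    ≡⟨ cong₂ _+_ negative nonNegative ⟩
  posDiffs S + (indicator (hasDiff S 0) + posDiffs S)
    ≡⟨ rearrange (posDiffs S) _ ⟩
  indicator (hasDiff S 0) + (posDiffs S + posDiffs S) ∎
  where
  open ≡-Reasoning
  shift : ℕ → ℤ
  shift i = ℤ.+ i ℤ.- ℤ.+ n
  2m+1≡m+[1+m] : ∀ m → 2 * m + 1 ≡ m + suc m
  2m+1≡m+[1+m] = solve-∀
  rearrange : ∀ a b → a + (b + a) ≡ b + (a + a)
  rearrange = solve-∀
  shift-< : ∀ {i} → i < n → shift (n ∸ suc i) ≡ -[1+ i ]
  shift-< {i} i<n = trans (cong (λ k → ℤ.+ (n ∸ suc i) ℤ.- ℤ.+ k) (sym (m∸n+n≡m i<n)))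
                          (+m-+[m+n]≡-+n (n ∸ suc i) (suc i))
  negative : countBelow (inDiff S ∘ shift) n ≡ posDiffs S
  negative = trans (sym (sumBelow-reverse _ n)) (sumBelow-cong n (λ i i<n →
    cong indicator (trans (cong (inDiff S) (shift-< i<n)) (inDiff-[1+] S i))))
  nonNegative : countBelow (λ i → inDiff S (shift (n + i))) (suc n) ≡ indicator (hasDiff S 0) + posDiffs S
  nonNegative = sumBelow-cong (suc n) (λ i _ →
    cong indicator (trans (cong (inDiff S) (+[m+n]-+m≡+n n i)) (inDiff-+ S i)))

hasDiff-≥ : (S : Vec Bool n) {d : ℕ} → n ≤ d → hasDiff S d ≡ false
hasDiff-≥ {n} S {d} n≤d = T-ext (λ t → let y , _ , y+d∈S = hasDiff⁻ S t
  in subst T (mem-≥ S (≤-trans n≤d (m≤n+m d y))) y+d∈S) λ ()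

hasDiff-cong : {m : ℕ} (U : Vec Bool m) (S : Vec Bool n) → (∀ x → mem U x ≡ mem S x) → ∀ d → hasDiff U d ≡ hasDiff S d
hasDiff-cong U S eq d = T-ext (transport U S eq) (transport S U (sym ∘ eq))
  where
  transport : {m k : ℕ} (U : Vec Bool m) (S : Vec Bool k) → (∀ x → mem U x ≡ mem S x) → T (hasDiff U d) → T (hasDiff S d)
  transport U S eq t = let y , y∈U , y+d∈U = hasDiff⁻ U t in hasDiff⁺ S (subst T (eq y) y∈U) (subst T (eq (y + d)) y+d∈U)

hasDiff-false∷ : (S : Vec Bool n) (d : ℕ) → hasDiff (false ∷ S) d ≡ hasDiff S d
hasDiff-false∷ S d = T-ext
  (λ t → case hasDiff⁻ (false ∷ S) t of λ where
    (suc y , y∈S , y+d∈S) → hasDiff⁺ S (subst T (mem-suc false S y) y∈S) (subst T (mem-suc false S (y + d)) y+d∈S))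
  (λ t → let y , y∈S , y+d∈S = hasDiff⁻ S t
         in hasDiff⁺ (false ∷ S) {suc y} (subst T (sym (mem-suc false S y)) y∈S) (subst T (sym (mem-suc false S (y + d))) y+d∈S))

-- The exact recursion

-- event K S unfolds to ⌊ defect S ≟ K ⌋.
defect : Vec Bool n → ℤ
defect {n} S = (ℤ.+ (2 * n) ℤ.- ℤ.+ 1) ℤ.- ℤ.+ diffSize S

event-shift : (U : Vec Bool (suc n)) (S : Vec Bool n) → defect U ≡ defect S ℤ.+ ℤ.+ 2 →
  ∀ K → event K U ≡ event (K ℤ.- ℤ.+ 2) S
event-shift U S eq K = T-ext
  (λ t → fromWitness (trans (sym (cancel (defect S) (ℤ.+ 2))) (cong (ℤ._- ℤ.+ 2) (trans (sym eq) (toWitness t)))))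
  (λ t → fromWitness (trans eq (trans (cong (ℤ._+ ℤ.+ 2) (toWitness t)) (uncancel K (ℤ.+ 2)))))
  where
  cancel : ∀ a b → (a ℤ.+ b) ℤ.- b ≡ a
  cancel = ZR.solve-∀
  uncancel : ∀ a b → (a ℤ.- b) ℤ.+ b ≡ a
  uncancel = ZR.solve-∀

+[2*1+n] : ∀ n → ℤ.+ (2 * suc n) ≡ ℤ.+ 2 ℤ.+ ℤ.+ (2 * n)
+[2*1+n] n = trans (cong ℤ.+_ (*-distribˡ-+ 2 1 n)) (ℤP.pos-+ 2 (2 * n))

defect-pad : (U : Vec Bool (suc n)) (S : Vec Bool n) → diffSize U ≡ diffSize S → defect U ≡ defect S ℤ.+ ℤ.+ 2
defect-pad {n} U S eq = trans (cong₂ (λ a b → (a ℤ.- ℤ.+ 1) ℤ.- ℤ.+ b) (+[2*1+n] n) eq)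
  (law (ℤ.+ (2 * n)) (ℤ.+ diffSize S))
  where
  law : ∀ a d → ((ℤ.+ 2 ℤ.+ a) ℤ.- ℤ.+ 1) ℤ.- d ≡ ((a ℤ.- ℤ.+ 1) ℤ.- d) ℤ.+ ℤ.+ 2
  law = ZR.solve-∀

defect-grow : (U : Vec Bool (suc n)) (S : Vec Bool n) → diffSize U ≡ 2 + diffSize S → defect U ≡ defect S
defect-grow {n} U S eq =
  trans (cong₂ (λ a b → (a ℤ.- ℤ.+ 1) ℤ.- b) (+[2*1+n] n) (trans (cong ℤ.+_ eq) (ℤP.pos-+ 2 (diffSize S))))
    (law (ℤ.+ (2 * n)) (ℤ.+ diffSize S))
  where
  law : ∀ a d → ((ℤ.+ 2 ℤ.+ a) ℤ.- ℤ.+ 1) ℤ.- (ℤ.+ 2 ℤ.+ d) ≡ (a ℤ.- ℤ.+ 1) ℤ.- d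
  law = ZR.solve-∀

diffSize-pad : (U : Vec Bool (suc n)) (S : Vec Bool n) → (∀ d → hasDiff U d ≡ hasDiff S d) → diffSize U ≡ diffSize S
diffSize-pad {n} U S eq = begin
  diffSize U                                                  ≡⟨ diffSize-≡ U ⟩
  indicator (hasDiff U 0) + (posDiffs U + posDiffs U)         ≡⟨ cong₂ (λ a b → indicator a + (b + b)) (eq 0) posDiffs-≡ ⟩
  indicator (hasDiff S 0) + (posDiffs S + posDiffs S)         ≡⟨ diffSize-≡ S ⟨
  diffSize S                                                  ∎
  where
  open ≡-Reasoning
  posDiffs-≡ : posDiffs U ≡ posDiffs S
  posDiffs-≡ = begin
    countBelow (λ i → hasDiff U (suc i)) (suc n)              ≡⟨ sumBelow-cong (suc n) (λ i _ → cong indicator (eq (suc i))) ⟩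
    countBelow (λ i → hasDiff S (suc i)) (suc n)              ≡⟨ sumBelow-last _ n ⟩
    posDiffs S + indicator (hasDiff S (suc n))                ≡⟨ cong (λ b → posDiffs S + indicator b) (hasDiff-≥ S (n≤1+n n)) ⟩
    posDiffs S + 0                                            ≡⟨ +-identityʳ _ ⟩
    posDiffs S                                                ∎

event-pad : (U : Vec Bool (suc n)) (S : Vec Bool n) → (∀ d → hasDiff U d ≡ hasDiff S d) →
  ∀ K → event K U ≡ event (K ℤ.- ℤ.+ 2) S
event-pad U S eq = event-shift U S (defect-pad U S (diffSize-pad U S eq))

event-false∷ : (S : Vec Bool n) (K : ℤ) → event K (false ∷ S) ≡ event (K ℤ.- ℤ.+ 2) S
event-false∷ S = event-pad (false ∷ S) S (hasDiff-false∷ S)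

event-append-false : (S : Vec Bool n) (K : ℤ) → event K (insertAt S (fromℕ n) false) ≡ event (K ℤ.- ℤ.+ 2) S
event-append-false {n} S = event-pad (insertAt S (fromℕ n) false) S (hasDiff-cong _ S mem-append)
  where
  mem-append : ∀ x → mem (insertAt S (fromℕ n) false) x ≡ mem S x
  mem-append x with <-cmp x n
  ... | tri< x<n _ _ = mem-insertAt-< S (fromℕ n) false (subst (x <_) (sym (toℕ-fromℕ n)) x<n)
  ... | tri≈ _ refl _ =
    trans (subst (λ k → mem (insertAt S (fromℕ n) false) k ≡ false) (toℕ-fromℕ n) (mem-insertAt-≡ S (fromℕ n) false))
          (sym (mem-≥ S ≤-refl))
  mem-append (suc x) | tri> _ _ (s≤s n≤x) =
    trans (mem-insertAt-> S (fromℕ n) false (subst (_≤ x) (sym (toℕ-fromℕ n)) n≤x))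
          (trans (mem-≥ S n≤x) (sym (mem-≥ S (m≤n⇒m≤1+n n≤x))))

ℓ# : ℕ → ℤ → ℕ
ℓ# n K = count n (event K)

j# : ℕ → ℤ → ℕ
j# n K = count n (λ S → ends S ∧ event K S)

ends-true∷-insertAt-last : {m : ℕ} (S : Vec Bool m) (b : Bool) → ends (true ∷ insertAt S (fromℕ m) b) ≡ b
ends-true∷-insertAt-last {m} S b = trans (mem-suc true (insertAt S (fromℕ m) b) m)
  (subst (λ k → mem (insertAt S (fromℕ m) b) k ≡ b) (toℕ-fromℕ m) (mem-insertAt-≡ S (fromℕ m) b))

count-ends : (m : ℕ) (P : Vec Bool (2 + m) → Bool) →
  count (2 + m) (λ S → ends S ∧ P S) ≡ count m (λ S → P (true ∷ insertAt S (fromℕ m) true))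
count-ends m P = begin
  count (2 + m) (λ S → ends S ∧ P S)
    ≡⟨ count-∷ {suc m} (λ S → ends S ∧ P S) ⟩
  count (suc m) (λ _ → false) + count (suc m) (λ S → ends (true ∷ S) ∧ P (true ∷ S))
    ≡⟨ cong₂ _+_ (count-false (suc m)) (count-insertAt (fromℕ m) _) ⟩
  count m (λ S → ends (true ∷ insertAt S (fromℕ m) false) ∧ P′ false S)
    + count m (λ S → ends (true ∷ insertAt S (fromℕ m) true) ∧ P′ true S)
    ≡⟨ cong₂ _+_ (count-cong {m} (λ S → cong (_∧ P′ false S) (ends-true∷-insertAt-last S false)))
                 (count-cong {m} (λ S → cong (_∧ P′ true S) (ends-true∷-insertAt-last S true))) ⟩
  count m (λ _ → false) + count m (P′ true)
    ≡⟨ cong (_+ count m (P′ true)) (count-false m) ⟩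
  count m (P′ true) ∎
  where
  open ≡-Reasoning
  P′ : Bool → Vec Bool m → Bool
  P′ b S = P (true ∷ insertAt S (fromℕ m) b)

ends-count : (m : ℕ) → count (2 + m) ends ≡ 2 ^ m
ends-count m = trans (count-cong {2 + m} (λ S → sym (∧-identityʳ (ends S)))) (trans (count-ends m (λ _ → true)) (count-true m))

ℓ#-recursion : (m : ℕ) (K : ℤ) →
  ℓ# (2 + m) K + ℓ# m ((K ℤ.- ℤ.+ 2) ℤ.- ℤ.+ 2) ≡ 2 * ℓ# (suc m) (K ℤ.- ℤ.+ 2) + j# (2 + m) K
ℓ#-recursion m K = begin
  ℓ# (2 + m) K + ℓ# m K″
    ≡⟨ cong (_+ ℓ# m K″) (count-∷ {suc m} (event K)) ⟩
  (count (suc m) (λ S → event K (false ∷ S)) + count (suc m) (λ S → event K (true ∷ S))) + ℓ# m K″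
    ≡⟨ cong₂ (λ x y → (x + y) + ℓ# m K″) (count-cong {suc m} (λ S → event-false∷ S K)) (count-insertAt (fromℕ m) _) ⟩
  (ℓ# (suc m) K′ + (count m (λ S → event K (true ∷ insertAt S (fromℕ m) false)) + both)) + ℓ# m K″
    ≡⟨ cong (λ x → (ℓ# (suc m) K′ + (x + both)) + ℓ# m K″) (count-cong {m} (λ S → event-append-false (true ∷ S) K)) ⟩
  (ℓ# (suc m) K′ + (first + both)) + ℓ# m K″
    ≡⟨ rearrange (ℓ# (suc m) K′) first both (ℓ# m K″) ⟩
  (ℓ# (suc m) K′ + (ℓ# m K″ + first)) + both
    ≡⟨ cong (λ x → (ℓ# (suc m) K′ + x) + both) ℓ#-first-bit ⟨
  (ℓ# (suc m) K′ + ℓ# (suc m) K′) + both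
    ≡⟨ cong₂ _+_ (cong (ℓ# (suc m) K′ +_) (+-identityʳ _)) (count-ends m (event K)) ⟨
  2 * ℓ# (suc m) K′ + j# (2 + m) K ∎
  where
  open ≡-Reasoning
  K′ K″ : ℤ
  K′ = K ℤ.- ℤ.+ 2
  K″ = K′ ℤ.- ℤ.+ 2
  first both : ℕ
  first = count m (λ S → event K′ (true ∷ S))
  both  = count m (λ S → event K (true ∷ insertAt S (fromℕ m) true))
  rearrange : ∀ w x y z → (w + (x + y)) + z ≡ (w + (z + x)) + y
  rearrange = solve-∀
  ℓ#-first-bit : ℓ# (suc m) K′ ≡ ℓ# m K″ + first
  ℓ#-first-bit = trans (count-∷ {m} (event K′)) (cong (_+ first) (count-cong {m} (λ S → event-false∷ S K′)))

-- Coupling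

infix 4 _≈[_]_

_≈[_]_ : ℕ → ℕ → ℕ → Set
a ≈[ e ] b = a ≤ b + e × b ≤ a + e

≈-sym : a ≈[ e ] b → b ≈[ e ] a
≈-sym (a≤b+e , b≤a+e) = b≤a+e , a≤b+e

≈-weaken : e ≤ f → a ≈[ e ] b → a ≈[ f ] b
≈-weaken {a = a} {b = b} e≤f (a≤b+e , b≤a+e) = ≤-trans a≤b+e (+-monoʳ-≤ b e≤f) , ≤-trans b≤a+e (+-monoʳ-≤ a e≤f)

≈-trans : a ≈[ e ] b → b ≈[ f ] c → a ≈[ e + f ] c
≈-trans {a = a} {e = e} {f = f} {c = c} (a≤b+e , b≤a+e) (b≤c+f , c≤b+f) =
  ≤-trans a≤b+e (≤-trans (+-monoˡ-≤ e b≤c+f) (≤-reflexive (reassociate c f e))) ,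
  ≤-trans c≤b+f (≤-trans (+-monoˡ-≤ f b≤a+e) (≤-reflexive (+-assoc a e f)))
  where
  reassociate : ∀ x y z → (x + y) + z ≡ x + (z + y)
  reassociate = solve-∀

≈-+ : a ≈[ e ] b → c ≈[ f ] d → a + c ≈[ e + f ] b + d
≈-+ {a = a} {e = e} {b = b} {c = c} {f = f} {d = d} (a≤b+e , b≤a+e) (c≤d+f , d≤c+f) =
  ≤-trans (+-mono-≤ a≤b+e c≤d+f) (≤-reflexive (+-interchange b e d f)) ,
  ≤-trans (+-mono-≤ b≤a+e d≤c+f) (≤-reflexive (+-interchange a e c f))

≈-+ˡ : (k : ℕ) → a ≈[ e ] b → k + a ≈[ e ] k + b
≈-+ˡ {a = a} {e = e} {b = b} k (a≤b+e , b≤a+e) =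
  ≤-trans (+-monoʳ-≤ k a≤b+e) (≤-reflexive (sym (+-assoc k b e))) ,
  ≤-trans (+-monoʳ-≤ k b≤a+e) (≤-reflexive (sym (+-assoc k a e)))

≈-*ˡ : (k : ℕ) → a ≈[ e ] b → k * a ≈[ k * e ] k * b
≈-*ˡ {a = a} {e = e} {b = b} k (a≤b+e , b≤a+e) =
  ≤-trans (*-monoʳ-≤ k a≤b+e) (≤-reflexive (*-distribˡ-+ k b e)) ,
  ≤-trans (*-monoʳ-≤ k b≤a+e) (≤-reflexive (*-distribˡ-+ k a e))

≈⇒∣-∣≤ : a ≈[ e ] b → ℤ.∣ ℤ.+ a ℤ.- ℤ.+ b ∣ ≤ e
≈⇒∣-∣≤ {a = a} {e = e} {b = b} (a≤b+e , b≤a+e) with ≤-total a b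
... | inj₁ a≤b = subst (_≤ e) (sym (trans ∣a-b∣≡∣a⊖b∣ (ℤP.∣⊖∣-≤ a≤b))) (m≤n+o⇒m∸n≤o b a b≤a+e)
  where ∣a-b∣≡∣a⊖b∣ = cong ℤ.∣_∣ (ℤP.m-n≡m⊖n a b)
... | inj₂ b≤a = subst (_≤ e) (sym (trans ∣a-b∣≡∣a⊖b∣ (trans (ℤP.∣m⊖n∣≡∣n⊖m∣ a b) (ℤP.∣⊖∣-≤ b≤a)))) (m≤n+o⇒m∸n≤o a b a≤b+e)
  where ∣a-b∣≡∣a⊖b∣ = cong ℤ.∣_∣ (ℤP.m-n≡m⊖n a b)

count-≈ : {P Q : Vec Bool n → Bool} (G : Vec Bool n → Bool) →
  (∀ S → T (G S) → P S ≡ Q S) → count n P ≈[ count n (not ∘ G) ] count n Q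
count-≈ {n} {P} {Q} G P≡Q = bound P Q P≡Q , bound Q P (λ S g → sym (P≡Q S g))
  where
  bound : (P Q : Vec Bool n → Bool) → (∀ S → T (G S) → P S ≡ Q S) → count n P ≤ count n Q + count n (not ∘ G)
  bound P Q P≡Q = ≤-trans (count-mono {P = P} {Q = λ S → Q S ∨ not (G S)} implication) (count-∨ Q (not ∘ G))
    where
    implication : ∀ S → T (P S) → T (Q S ∨ not (G S))
    implication S p with G S in g
    ... | true  = Equivalence.from T-∨ (inj₁ (subst T (P≡Q S (subst T (sym g) _)) p))
    ... | false = Equivalence.from (T-∨ {Q S}) (inj₂ _)

Good : ℕ → Vec Bool n → Bool
Good {n} L S = allBelow (λ i → hasDiff S (suc i)) (n ∸ suc L)

bad : ℕ → ℕ → ℕ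
bad L n = count n (not ∘ Good L)

hasDiff⇒hasDiff-0 : (S : Vec Bool n) {d : ℕ} → T (hasDiff S d) → T (hasDiff S 0)
hasDiff⇒hasDiff-0 S t = let y , y∈S , _ = hasDiff⁻ S t in hasDiff⁺ S y∈S (subst (T ∘ mem S) (sym (+-identityʳ y)) y∈S)

-- A long difference e straddles position i, so inserting a point there lengthens it by one.
hasDiff-insertAt : (S : Vec Bool n) (i : Fin (suc n)) (b : Bool) {e : ℕ} →
  toℕ i ≤ e → n ≤ e + toℕ i → hasDiff (insertAt S i b) (suc e) ≡ hasDiff S e
hasDiff-insertAt {n} S i b {e} i≤e n≤e+i = T-ext forward backward
  where
  U : Vec Bool (suc n)
  U = insertAt S i b
  left-end : ∀ {y} → y + e < n → y < toℕ i
  left-end {y} y+e<n = +-cancelʳ-< e y (toℕ i) (<-≤-trans y+e<n (≤-trans n≤e+i (≤-reflexive (+-comm e (toℕ i)))))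
  forward : T (hasDiff U (suc e)) → T (hasDiff S e)
  forward t =
    let y , y∈U , y+1+e∈U = hasDiff⁻ U t
        y+e+1∈U = subst (T ∘ mem U) (+-suc y e) y+1+e∈U
        y<i = left-end (s≤s⁻¹ (mem⇒< U y+e+1∈U))
    in hasDiff⁺ S {y} (subst T (mem-insertAt-< S i b y<i) y∈U)
                  (subst T (mem-insertAt-> S i b (≤-trans i≤e (m≤n+m e y))) y+e+1∈U)
  backward : T (hasDiff S e) → T (hasDiff U (suc e))
  backward t =
    let y , y∈S , y+e∈S = hasDiff⁻ S t
        y<i = left-end (mem⇒< S y+e∈S)
    in hasDiff⁺ U {y} (subst T (sym (mem-insertAt-< S i b y<i)) y∈S)
                  (subst (T ∘ mem U) (sym (+-suc y e))
                    (subst T (sym (mem-insertAt-> S i b (≤-trans i≤e (m≤n+m e y)))) y+e∈S))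

posDiffs-short : (S : Vec Bool n) (q : ℕ) → q ≤ n → (∀ i → i < q → T (hasDiff S (suc i))) →
  posDiffs S ≡ q + countBelow (λ i → hasDiff S (suc (q + i))) (n ∸ q)
posDiffs-short {n} S q q≤n short = begin
  countBelow (hasDiff S ∘ suc) n              ≡⟨ cong (countBelow (hasDiff S ∘ suc)) (m+[n∸m]≡n q≤n) ⟨
  countBelow (hasDiff S ∘ suc) (q + (n ∸ q))  ≡⟨ sumBelow-+ _ q (n ∸ q) ⟩
  countBelow (hasDiff S ∘ suc) q + tail       ≡⟨ cong (_+ tail) (countBelow-true _ q short) ⟩
  q + tail                                    ∎
  where
  open ≡-Reasoning
  tail = countBelow (λ i → hasDiff S (suc (q + i))) (n ∸ q)

diffSize-short : (S : Vec Bool n) (q : ℕ) → 0 < q → q ≤ n → (∀ i → i < q → T (hasDiff S (suc i))) →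
  diffSize S ≡ 1 + 2 * (q + countBelow (λ i → hasDiff S (suc (q + i))) (n ∸ q))
diffSize-short S q 0<q q≤n short = begin
  diffSize S                                                   ≡⟨ diffSize-≡ S ⟩
  indicator (hasDiff S 0) + (posDiffs S + posDiffs S)          ≡⟨ cong₂ (λ b p → indicator b + (p + p)) nonempty (posDiffs-short S q q≤n short) ⟩
  1 + (q + tail + (q + tail))                                  ≡⟨ cong suc (+-*-double (q + tail)) ⟩
  1 + 2 * (q + tail)                                           ∎
  where
  open ≡-Reasoning
  tail = countBelow (λ i → hasDiff S (suc (q + i))) (_ ∸ q)
  nonempty : hasDiff S 0 ≡ true
  nonempty = Equivalence.to T-≡ (hasDiff⇒hasDiff-0 S (short 0 0<q))
  +-*-double : ∀ x → x + x ≡ 2 * x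
  +-*-double = solve-∀

diffSize-insertAt-Good : (L : ℕ) (S : Vec Bool n) (b : Bool) (L<1+n : L < suc n) → suc L ≤ n ∸ suc L →
  T (Good L S) → T (Good L (insertAt S (fromℕ< L<1+n) b)) → diffSize (insertAt S (fromℕ< L<1+n) b) ≡ 2 + diffSize S
diffSize-insertAt-Good {n} L S b L<1+n 1+L≤q good-S good-U = begin
  diffSize U                                                   ≡⟨ diffSize-short U (suc q) z<s (s≤s q≤n) short-U ⟩
  1 + 2 * (suc q + tail U (suc q))                             ≡⟨ cong (λ t → 1 + 2 * (suc q + t)) tails-agree ⟩
  1 + 2 * (suc q + tail S q)                                   ≡⟨ arithmetic q (tail S q) ⟩
  2 + (1 + 2 * (q + tail S q))                                 ≡⟨ cong (2 +_) (diffSize-short S q (≤-trans (s≤s z≤n) 1+L≤q) q≤n short-S) ⟨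
  2 + diffSize S                                               ∎
  where
  open ≡-Reasoning
  q = n ∸ suc L
  i = fromℕ< L<1+n
  U = insertAt S i b
  q≤n : q ≤ n
  q≤n = m∸n≤m n (suc L)
  n≡q+1+L : n ≡ q + suc L
  n≡q+1+L = sym (m∸n+n≡m (≤-trans 1+L≤q q≤n))
  tail : {k : ℕ} → Vec Bool k → ℕ → ℕ
  tail {k} V r = countBelow (λ j → hasDiff V (suc (r + j))) (k ∸ r)
  arithmetic : ∀ q t → 1 + 2 * (suc q + t) ≡ 2 + (1 + 2 * (q + t))
  arithmetic = solve-∀
  short-S : ∀ j → j < q → T (hasDiff S (suc j))
  short-S = allBelow⁻ _ q good-S
  short-U : ∀ j → j < suc q → T (hasDiff U (suc j))
  short-U j j<1+q = allBelow⁻ _ (suc n ∸ suc L) good-U j (subst (j <_) (sym n∸L≡1+q) j<1+q)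
    where
    n∸L≡1+q : n ∸ L ≡ suc q
    n∸L≡1+q = trans (cong (_∸ L) (trans n≡q+1+L (+-suc q L))) (m+n∸n≡m (suc q) L)
  tails-agree : tail U (suc q) ≡ tail S q
  tails-agree = sumBelow-cong (n ∸ q) (λ j _ → cong indicator (hasDiff-insertAt S i b (i≤e j) (n≤e+i j)))
    where
    i≤e : ∀ j → toℕ i ≤ suc (q + j)
    i≤e j = subst (_≤ suc (q + j)) (sym (toℕ-fromℕ< L<1+n))
      (≤-trans (n≤1+n L) (≤-trans 1+L≤q (≤-trans (m≤m+n q j) (n≤1+n _))))
    n≤e+i : ∀ j → n ≤ suc (q + j) + toℕ i
    n≤e+i j = subst (λ l → n ≤ suc (q + j) + l) (sym (toℕ-fromℕ< L<1+n))
      (subst (_≤ suc (q + j) + L) (sym n≡q+1+L) (≤-trans (≤-reflexive (+-suc q L)) (s≤s (+-monoˡ-≤ L (m≤m+n q j)))))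

-- Inserting a point in the middle of a good set leaves the defect unchanged.
coupling : (L : ℕ) → suc L ≤ n ∸ suc L → (K : ℤ) →
  ℓ# (suc n) K ≈[ 2 * bad L n + bad L (suc n) ] 2 * ℓ# n K
coupling {n} L 1+L≤q K =
  subst₂ (_≈[ 2 * bad L n + bad L (suc n) ]_) (sym (count-insertAt i (event K))) (double (ℓ# n K))
    (≈-weaken (≤-reflexive total-error) (≈-+ (approximation false) (approximation true)))
  where
  L<1+n : L < suc n
  L<1+n = s≤s (≤-trans (n≤1+n L) (≤-trans 1+L≤q (m∸n≤m n (suc L))))
  i = fromℕ< L<1+n
  badAfter : Bool → ℕ
  badAfter b = count n (λ S → not (Good L (insertAt S i b)))
  approximation : (b : Bool) → count n (λ S → event K (insertAt S i b)) ≈[ bad L n + badAfter b ] ℓ# n K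
  approximation b = ≈-weaken
    (≤-trans (count-mono {n} (λ S → T-not-∧ (Good L S))) (count-∨ (not ∘ Good L) (λ S → not (Good L (insertAt S i b)))))
    (count-≈ (λ S → Good L S ∧ Good L (insertAt S i b)) (λ S good →
      let good-S , good-U = Equivalence.to T-∧ good
      in cong (λ d → ⌊ d ℤ.≟ K ⌋) (defect-grow (insertAt S i b) S (diffSize-insertAt-Good L S b L<1+n 1+L≤q good-S good-U))))
  double : ∀ x → x + x ≡ 2 * x
  double = solve-∀
  total-error : (bad L n + badAfter false) + (bad L n + badAfter true) ≡ 2 * bad L n + bad L (suc n)
  total-error = trans (+-interchange (bad L n) _ _ _)
    (cong₂ _+_ (double (bad L n)) (sym (count-insertAt i (not ∘ Good L))))

-- Sets missing a difference

Ignores : (Vec Bool n → Bool) → ℕ → Set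
Ignores {n} P x = ∀ S S′ → (∀ y → y ≢ x → mem S y ≡ mem S′ y) → P S ≡ P S′

Ignores-∷ : {P : Vec Bool (suc n) → Bool} {x : ℕ} → Ignores P (suc x) → (b : Bool) → Ignores (λ S → P (b ∷ S)) x
Ignores-∷ ignores b S S′ agree = ignores (b ∷ S) (b ∷ S′) λ where
  zero    _   → refl
  (suc y) y≢x → trans (mem-suc b S y) (trans (agree y (y≢x ∘ cong suc)) (sym (mem-suc b S′ y)))

Ignores-0 : {P : Vec Bool (suc n) → Bool} → Ignores P 0 → ∀ S → P (false ∷ S) ≡ P (true ∷ S)
Ignores-0 ignores S = ignores (false ∷ S) (true ∷ S) λ where
  zero    0≢0 → ⊥-elim (0≢0 refl)
  (suc y) _   → trans (mem-suc false S y) (sym (mem-suc true S y))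

private
  count-∧-step : (P Q : Vec Bool (suc n) → Bool) → Ignores P 0 →
    (∀ b c → count n (λ S → P (b ∷ S) ∧ Q (c ∷ S)) * 2 ^ n ≡ count n (λ S → P (b ∷ S)) * count n (λ S → Q (c ∷ S))) →
    count (suc n) (λ S → P S ∧ Q S) * 2 ^ suc n ≡ count (suc n) P * count (suc n) Q
  count-∧-step {n} P Q P-ignores-0 restricted = begin
    count (suc n) (λ S → P S ∧ Q S) * 2 ^ suc n
      ≡⟨ cong (_* 2 ^ suc n) (count-∷ {n} (λ S → P S ∧ Q S)) ⟩
    (count n (λ S → P₀ S ∧ Q₀ S) + count n (λ S → P₁ S ∧ Q₁ S)) * (2 * 2 ^ n)
      ≡⟨ cong (λ c → (count n (λ S → P₀ S ∧ Q₀ S) + c) * (2 * 2 ^ n)) (count-cong {n} (λ S → cong (_∧ Q₁ S) (sym (P₀≡P₁ S)))) ⟩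
    (count n (λ S → P₀ S ∧ Q₀ S) + count n (λ S → P₀ S ∧ Q₁ S)) * (2 * 2 ^ n)
      ≡⟨ distribute (count n (λ S → P₀ S ∧ Q₀ S)) (count n (λ S → P₀ S ∧ Q₁ S)) (2 ^ n) ⟩
    2 * (count n (λ S → P₀ S ∧ Q₀ S) * 2 ^ n + count n (λ S → P₀ S ∧ Q₁ S) * 2 ^ n)
      ≡⟨ cong (2 *_) (cong₂ _+_ (restricted false false) (restricted false true)) ⟩
    2 * (count n P₀ * count n Q₀ + count n P₀ * count n Q₁)
      ≡⟨ regroup (count n P₀) (count n Q₀) (count n Q₁) ⟩
    (count n P₀ + count n P₀) * (count n Q₀ + count n Q₁)
      ≡⟨ cong (λ c → (count n P₀ + c) * (count n Q₀ + count n Q₁)) (count-cong P₀≡P₁) ⟩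
    (count n P₀ + count n P₁) * (count n Q₀ + count n Q₁)
      ≡⟨ cong₂ _*_ (count-∷ P) (count-∷ Q) ⟨
    count (suc n) P * count (suc n) Q ∎
    where
    open ≡-Reasoning
    P₀ P₁ Q₀ Q₁ : Vec Bool n → Bool
    P₀ S = P (false ∷ S)
    P₁ S = P (true ∷ S)
    Q₀ S = Q (false ∷ S)
    Q₁ S = Q (true ∷ S)
    P₀≡P₁ : ∀ S → P₀ S ≡ P₁ S
    P₀≡P₁ = Ignores-0 P-ignores-0
    distribute : ∀ x y t → (x + y) * (2 * t) ≡ 2 * (x * t + y * t)
    distribute = solve-∀
    regroup : ∀ p q r → 2 * (p * q + p * r) ≡ (p + p) * (q + r)
    regroup = solve-∀

count-independent : (P Q : Vec Bool n → Bool) → (∀ x → Ignores P x ⊎ Ignores Q x) →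
  count n (λ S → P S ∧ Q S) * 2 ^ n ≡ count n P * count n Q
count-independent {zero} P Q _ with P [] | Q []
... | true  | true  = refl
... | true  | false = refl
... | false | _     = refl
count-independent {suc n} P Q disjoint with disjoint 0
... | inj₁ P-ignores-0 = count-∧-step P Q P-ignores-0 (λ b c →
  count-independent (λ S → P (b ∷ S)) (λ S → Q (c ∷ S))
    (λ x → Sum.map (λ i → Ignores-∷ i b) (λ i → Ignores-∷ i c) (disjoint (suc x))))
... | inj₂ Q-ignores-0 = begin
  count (suc n) (λ S → P S ∧ Q S) * 2 ^ suc n
    ≡⟨ cong (_* 2 ^ suc n) (count-cong {suc n} (λ S → ∧-comm (P S) (Q S))) ⟩
  count (suc n) (λ S → Q S ∧ P S) * 2 ^ suc n
    ≡⟨ count-∧-step Q P Q-ignores-0 (λ c b →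
         count-independent (λ S → Q (c ∷ S)) (λ S → P (b ∷ S))
           (λ x → Sum.map (λ i → Ignores-∷ i c) (λ i → Ignores-∷ i b) (Sum.swap (disjoint (suc x))))) ⟩
  count (suc n) Q * count (suc n) P
    ≡⟨ *-comm (count (suc n) Q) _ ⟩
  count (suc n) P * count (suc n) Q ∎
  where open ≡-Reasoning

mem-insertAt-fromℕ< : (S : Vec Bool n) {x : ℕ} (x<1+n : x < suc n) (b : Bool) → mem (insertAt S (fromℕ< x<1+n) b) x ≡ b
mem-insertAt-fromℕ< S x<1+n b =
  subst (λ k → mem (insertAt S (fromℕ< x<1+n) b) k ≡ b) (toℕ-fromℕ< x<1+n) (mem-insertAt-≡ S (fromℕ< x<1+n) b)

count-mem : {x : ℕ} → x < suc n → count (suc n) (λ S → mem S x) * 2 ≡ 2 ^ suc n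
count-mem {n} {x} x<1+n = begin
  count (suc n) (λ S → mem S x) * 2
    ≡⟨ cong (_* 2) (count-insertAt i (λ S → mem S x)) ⟩
  (count n (λ S → mem (insertAt S i false) x) + count n (λ S → mem (insertAt S i true) x)) * 2
    ≡⟨ cong (_* 2) (cong₂ _+_ (count-cong (λ S → mem-insertAt-fromℕ< S x<1+n false))
                              (count-cong (λ S → mem-insertAt-fromℕ< S x<1+n true))) ⟩
  (count n (λ _ → false) + count n (λ _ → true)) * 2
    ≡⟨ cong (_* 2) (cong₂ _+_ (count-false n) (count-true n)) ⟩
  2 ^ n * 2
    ≡⟨ *-comm (2 ^ n) 2 ⟩
  2 ^ suc n ∎
  where
  open ≡-Reasoning
  i = fromℕ< x<1+n

Ignores-mem : {x y : ℕ} → x ≢ y → Ignores {n} (λ S → mem S x) y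
Ignores-mem x≢y S S′ agree = agree _ x≢y

count-mem-pair : {x y : ℕ} → x ≢ y → x < n → y < n → count n (λ S → mem S x ∧ mem S y) * 4 ≡ 2 ^ n
count-mem-pair {suc n} {x} {y} x≢y x<n y<n = *-cancelʳ-≡ _ _ (2 ^ suc n) {{m^n≢0 2 (suc n)}} (begin
  both * 4 * 2 ^ suc n           ≡⟨ swap both 4 (2 ^ suc n) ⟩
  both * 2 ^ suc n * 4           ≡⟨ cong (_* 4) (count-independent {suc n} (λ S → mem S x) (λ S → mem S y) disjoint) ⟩
  count (suc n) (λ S → mem S x) * count (suc n) (λ S → mem S y) * 4
                                 ≡⟨ split (count (suc n) (λ S → mem S x)) _ ⟩
  (count (suc n) (λ S → mem S x) * 2) * (count (suc n) (λ S → mem S y) * 2)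
                                 ≡⟨ cong₂ _*_ (count-mem x<n) (count-mem y<n) ⟩
  2 ^ suc n * 2 ^ suc n          ∎)
  where
  open ≡-Reasoning
  both = count (suc n) (λ S → mem S x ∧ mem S y)
  swap : ∀ a b c → a * b * c ≡ a * c * b
  swap = solve-∀
  split : ∀ a b → a * b * 4 ≡ (a * 2) * (b * 2)
  split = solve-∀
  disjoint : ∀ z → Ignores (λ S → mem S x) z ⊎ Ignores (λ S → mem S y) z
  disjoint z with z ≟ x
  ... | yes refl = inj₂ (Ignores-mem (x≢y ∘ sym))
  ... | no  z≢x  = inj₁ (Ignores-mem (z≢x ∘ sym))

count-pairFree : {x d : ℕ} → 0 < d → x + d < n → count n (λ S → not (mem S x ∧ mem S (x + d))) * 4 ≡ 3 * 2 ^ n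
count-pairFree {n} {x} {d} 0<d x+d<n = +-cancelˡ-≡ (2 ^ n) _ _ (begin
  2 ^ n + free * 4                            ≡⟨ cong (_+ free * 4) (count-mem-pair x≢x+d (≤-trans (s≤s (m≤m+n x d)) x+d<n) x+d<n) ⟨
  both * 4 + free * 4                         ≡⟨ *-distribʳ-+ 4 both free ⟨
  (both + free) * 4                           ≡⟨ cong (_* 4) (count-complement {n} (λ S → mem S x ∧ mem S (x + d))) ⟩
  2 ^ n * 4                                   ≡⟨ split (2 ^ n) ⟩
  2 ^ n + 3 * 2 ^ n                           ∎)
  where
  open ≡-Reasoning
  both = count n (λ S → mem S x ∧ mem S (x + d))
  free = count n (λ S → not (mem S x ∧ mem S (x + d)))
  x≢x+d : x ≢ x + d
  x≢x+d = <⇒≢ (m<m+n x 0<d)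
  split : ∀ t → t * 4 ≡ t + 3 * t
  split = solve-∀

pairsFree : (ℕ → Bool) → ℕ → ℕ → Vec Bool n → Bool
pairsFree p d m S = allBelow (λ x → not (p x ∧ mem S x ∧ mem S (x + d))) m

Ignores-pairsFree : (p : ℕ → Bool) (d m z : ℕ) → (∀ x → x < m → T (p x) → x ≢ z × x + d ≢ z) →
  Ignores {n} (pairsFree p d m) z
Ignores-pairsFree p d m z avoids S S′ agree = allBelow-cong m conjunct
  where
  conjunct : ∀ x → x < m → not (p x ∧ mem S x ∧ mem S (x + d)) ≡ not (p x ∧ mem S′ x ∧ mem S′ (x + d))
  conjunct x x<m with p x in px
  ... | false = refl
  ... | true  = let x≢z , x+d≢z = avoids x x<m (subst T (sym px) _)
                in cong₂ (λ a b → not (a ∧ b)) (agree x x≢z) (agree (x + d) x+d≢z)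

pairsFree-disjoint : (p : ℕ → Bool) {d : ℕ} (m : ℕ) → (∀ x → T (p x) → ¬ T (p (x + d))) → T (p m) →
  ∀ z → Ignores {n} (pairsFree p d m) z ⊎ Ignores {n} (λ S → not (mem S m ∧ mem S (m + d))) z
pairsFree-disjoint p {d} m isolated pm z with z ≟ m | z ≟ m + d
... | yes refl | _        = inj₁ (Ignores-pairsFree p d m m (λ x x<m px →
      <⇒≢ x<m , λ x+d≡m → isolated x px (subst (T ∘ p) (sym x+d≡m) pm)))
... | no _     | yes refl = inj₁ (Ignores-pairsFree p d m (m + d) (λ x x<m _ →
      <⇒≢ (<-≤-trans x<m (m≤m+n m d)) , <⇒≢ (+-monoˡ-< d x<m)))
... | no z≢m   | no z≢m+d = inj₂ (λ S S′ agree →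
      cong₂ (λ a b → not (a ∧ b)) (agree m (z≢m ∘ sym)) (agree (m + d) (z≢m+d ∘ sym)))

count-pairsFree : (p : ℕ → Bool) {d : ℕ} (m : ℕ) → 0 < d → m + d ≤ n → (∀ x → T (p x) → ¬ T (p (x + d))) →
  count n (pairsFree p d m) * 4 ^ countBelow p m ≡ 3 ^ countBelow p m * 2 ^ n
count-pairsFree {n} p zero    _ _ _ = trans (*-identityʳ _) (trans (count-true n) (sym (+-identityʳ _)))
count-pairsFree {n} p {d} (suc m) 0<d 1+m+d≤n isolated =
  subst (λ j → count n (pairsFree p d (suc m)) * 4 ^ j ≡ 3 ^ j * 2 ^ n) (sym (sumBelow-last (indicator ∘ p) m)) (step (p m) refl)
  where
  k = countBelow p m
  t = 2 ^ n
  previous : count n (pairsFree p d m) * 4 ^ k ≡ 3 ^ k * t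
  previous = count-pairsFree p m 0<d (<⇒≤ 1+m+d≤n) isolated
  ^-+1 : ∀ a → a ^ (k + 1) ≡ a ^ k * a
  ^-+1 a = trans (cong (a ^_) (+-comm k 1)) (*-comm a (a ^ k))
  new : Vec Bool n → Bool
  new S = not (mem S m ∧ mem S (m + d))
  step : (b : Bool) → p m ≡ b → count n (pairsFree p d (suc m)) * 4 ^ (k + indicator b) ≡ 3 ^ (k + indicator b) * t
  step false pm≡false = begin
    count n (pairsFree p d (suc m)) * 4 ^ (k + 0)
      ≡⟨ cong₂ _*_ (count-cong {n} (λ S → trans (cong (λ b → pairsFree p d m S ∧ not (b ∧ mem S m ∧ mem S (m + d))) pm≡false) (∧-identityʳ _)))
                   (cong (4 ^_) (+-identityʳ k)) ⟩
    count n (pairsFree p d m) * 4 ^ k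
      ≡⟨ previous ⟩
    3 ^ k * t
      ≡⟨ cong (λ j → 3 ^ j * t) (+-identityʳ k) ⟨
    3 ^ (k + 0) * t ∎
    where open ≡-Reasoning
  step true pm≡true = *-cancelʳ-≡ _ _ t {{m^n≢0 2 n}} (begin
    count n (pairsFree p d (suc m)) * 4 ^ (k + 1) * t
      ≡⟨ cong₂ (λ x y → x * y * t) (count-cong {n} (λ S → cong (λ b → pairsFree p d m S ∧ not (b ∧ mem S m ∧ mem S (m + d))) pm≡true))
                                 (^-+1 4) ⟩
    count n (λ S → pairsFree p d m S ∧ new S) * (4 ^ k * 4) * t
      ≡⟨ regroup₁ (count n (λ S → pairsFree p d m S ∧ new S)) (4 ^ k) t ⟩
    (count n (λ S → pairsFree p d m S ∧ new S) * t) * (4 ^ k * 4)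
      ≡⟨ cong (_* (4 ^ k * 4)) (count-independent (pairsFree p d m) new (pairsFree-disjoint p m isolated (subst T (sym pm≡true) _))) ⟩
    (count n (pairsFree p d m) * count n new) * (4 ^ k * 4)
      ≡⟨ regroup₂ (count n (pairsFree p d m)) (count n new) (4 ^ k) ⟩
    (count n (pairsFree p d m) * 4 ^ k) * (count n new * 4)
      ≡⟨ cong₂ _*_ previous (count-pairFree 0<d 1+m+d≤n) ⟩
    (3 ^ k * t) * (3 * t)
      ≡⟨ regroup₃ (3 ^ k) t ⟩
    (3 ^ k * 3) * t * t
      ≡⟨ cong (λ j → j * t * t) (^-+1 3) ⟨
    3 ^ (k + 1) * t * t ∎)
    where
    open ≡-Reasoning
    regroup₁ : ∀ x f t → x * (f * 4) * t ≡ (x * t) * (f * 4)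
    regroup₁ = solve-∀
    regroup₂ : ∀ a b f → (a * b) * (f * 4) ≡ (a * f) * (b * 4)
    regroup₂ = solve-∀
    regroup₃ : ∀ g t → (g * t) * (3 * t) ≡ (g * 3) * t * t
    regroup₃ = solve-∀

-- Marking the first half of each block of length 2D yields about m/2 disjoint pairs {x, x + D} below m.
module HalfBlocks (D : ℕ) .{{_ : NonZero D}} where

  private instance
    2D≢0 : NonZero (2 * D)
    2D≢0 = m*n≢0 2 D

  firstHalf : ℕ → Bool
  firstHalf x = x % (2 * D) <ᵇ D

  D<2D : D < 2 * D
  D<2D = m<m+n D (≤-trans (>-nonZero⁻¹ D) (m≤m+n D 0))

  firstHalf-< : ∀ {x} → x < D → T (firstHalf x)
  firstHalf-< {x} x<D = <⇒<ᵇ (subst (_< D) (sym (m<n⇒m%n≡m (<-trans x<D D<2D))) x<D)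

  firstHalf-≥ : ∀ {x} → D ≤ x → x < 2 * D → ¬ T (firstHalf x)
  firstHalf-≥ {x} D≤x x<2D first = <⇒≱ (subst (_< D) (m<n⇒m%n≡m x<2D) (<ᵇ⇒< _ D first)) D≤x

  firstHalf-periodic : ∀ x → firstHalf (2 * D + x) ≡ firstHalf x
  firstHalf-periodic x = cong (_<ᵇ D) (trans (cong (_% (2 * D)) (+-comm (2 * D) x)) ([m+n]%n≡m%n x (2 * D)))

  firstHalf-isolated : ∀ x → T (firstHalf x) → ¬ T (firstHalf (x + D))
  firstHalf-isolated x first second = <⇒≱ (<ᵇ⇒< _ D second) (≤-trans (m≤n+m D r) (≤-reflexive (sym shifted)))
    where
    r = x % (2 * D)
    r+D<2D : r + D < 2 * D
    r+D<2D = subst (r + D <_) (cong (D +_) (sym (+-identityʳ D))) (+-monoˡ-< D (<ᵇ⇒< r D first))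
    shifted : (x + D) % (2 * D) ≡ r + D
    shifted = begin
      (x + D) % (2 * D)                      ≡⟨ %-distribˡ-+ x D (2 * D) ⟩
      (r + D % (2 * D)) % (2 * D)            ≡⟨ cong (λ s → (r + s) % (2 * D)) (m<n⇒m%n≡m D<2D) ⟩
      (r + D) % (2 * D)                      ≡⟨ m<n⇒m%n≡m r+D<2D ⟩
      r + D                                  ∎
      where open ≡-Reasoning

  countBelow-firstHalf-≤D : ∀ {m} → m ≤ D → countBelow firstHalf m ≡ m
  countBelow-firstHalf-≤D {m} m≤D = countBelow-true firstHalf m (λ i i<m → firstHalf-< (<-≤-trans i<m m≤D))

  countBelow-firstHalf-≤2D : ∀ {m} → D ≤ m → m ≤ 2 * D → countBelow firstHalf m ≡ D
  countBelow-firstHalf-≤2D {m} D≤m m≤2D = begin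
    countBelow firstHalf m                                       ≡⟨ cong (countBelow firstHalf) (m+[n∸m]≡n D≤m) ⟨
    countBelow firstHalf (D + (m ∸ D))                           ≡⟨ sumBelow-+ _ D (m ∸ D) ⟩
    countBelow firstHalf D + countBelow (λ i → firstHalf (D + i)) (m ∸ D)
                                                                 ≡⟨ cong₂ _+_ (countBelow-firstHalf-≤D ≤-refl) second-half ⟩
    D + 0                                                        ≡⟨ +-identityʳ D ⟩
    D                                                            ∎
    where
    open ≡-Reasoning
    second-half : countBelow (λ i → firstHalf (D + i)) (m ∸ D) ≡ 0
    second-half = countBelow-false _ (m ∸ D) (λ i i<m∸D → firstHalf-≥ (m≤m+n D i)
      (<-≤-trans (+-monoʳ-< D i<m∸D) (≤-trans (≤-reflexive (m+[n∸m]≡n D≤m)) m≤2D)))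

  firstHalf-dense : ∀ m → m ≤ 2 * countBelow firstHalf m
  firstHalf-dense = <-rec _ dense
    where
    dense : ∀ m → (∀ {r} → r < m → r ≤ 2 * countBelow firstHalf r) → m ≤ 2 * countBelow firstHalf m
    dense m rec with m ≤? D | m ≤? 2 * D
    ... | yes m≤D | _ = subst (λ c → m ≤ 2 * c) (sym (countBelow-firstHalf-≤D m≤D)) (m≤n*m m 2)
    ... | no  m≰D | yes m≤2D = subst (λ c → m ≤ 2 * c) (sym (countBelow-firstHalf-≤2D (<⇒≤ (≰⇒> m≰D)) m≤2D)) m≤2D
    ... | no  _   | no m≰2D = begin
      m                                                          ≡⟨ m+[n∸m]≡n 2D≤m ⟨
      2 * D + r                                                  ≤⟨ +-monoʳ-≤ (2 * D) (rec r<m) ⟩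
      2 * D + 2 * countBelow firstHalf r                         ≡⟨ *-distribˡ-+ 2 D _ ⟨
      2 * (D + countBelow firstHalf r)                           ≡⟨ cong (2 *_) (cong₂ _+_ (countBelow-firstHalf-≤2D D≤2D ≤-refl)
                                                                      (sumBelow-cong r (λ i _ → cong indicator (firstHalf-periodic i)))) ⟨
      2 * (countBelow firstHalf (2 * D) + countBelow (λ i → firstHalf (2 * D + i)) r)
                                                                 ≡⟨ cong (2 *_) (sumBelow-+ _ (2 * D) r) ⟨
      2 * countBelow firstHalf (2 * D + r)                       ≡⟨ cong (λ k → 2 * countBelow firstHalf k) (m+[n∸m]≡n 2D≤m) ⟩
      2 * countBelow firstHalf m                                 ∎
      where
      open ≤-Reasoning
      2D≤m = <⇒≤ (≰⇒> m≰2D)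
      D≤2D = <⇒≤ D<2D
      r = m ∸ 2 * D
      r<m : r < m
      r<m = ∸-monoʳ-< {o = 0} (<-trans (>-nonZero⁻¹ D) D<2D) 2D≤m

-- 3/4 ≤ (7/8)², as 3 · 64 ≤ 4 · 49.
3^k*8^m≤7^m*4^k : ∀ k m → m ≤ 2 * k → 3 ^ k * 8 ^ m ≤ 7 ^ m * 4 ^ k
3^k*8^m≤7^m*4^k k       zero             _ = begin
  3 ^ k * 1        ≡⟨ *-identityʳ (3 ^ k) ⟩
  3 ^ k            ≤⟨ ^-monoˡ-≤ k (m≤m+n 3 1) ⟩
  4 ^ k            ≡⟨ +-identityʳ (4 ^ k) ⟨
  1 * 4 ^ k        ∎
  where open ≤-Reasoning
3^k*8^m≤7^m*4^k (suc k) (suc zero)       _ = begin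
  3 * 3 ^ k * 8     ≡⟨ solve-∀′ (3 ^ k) ⟩
  24 * 3 ^ k        ≤⟨ *-mono-≤ (m≤m+n 24 4) (^-monoˡ-≤ k (m≤m+n 3 1)) ⟩
  28 * 4 ^ k        ≡⟨ solve-∀″ (4 ^ k) ⟩
  7 * 1 * (4 * 4 ^ k) ∎
  where
  open ≤-Reasoning
  solve-∀′ : ∀ x → 3 * x * 8 ≡ 24 * x
  solve-∀′ = solve-∀
  solve-∀″ : ∀ x → 28 * x ≡ 7 * 1 * (4 * x)
  solve-∀″ = solve-∀
3^k*8^m≤7^m*4^k (suc k) (suc (suc m)) m≤2k+2 = begin
  3 * 3 ^ k * (8 * (8 * 8 ^ m))   ≡⟨ factor₁ (3 ^ k) (8 ^ m) ⟩
  192 * (3 ^ k * 8 ^ m)           ≤⟨ *-mono-≤ (m≤m+n 192 4) (3^k*8^m≤7^m*4^k k m m≤2k) ⟩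
  196 * (7 ^ m * 4 ^ k)           ≡⟨ factor₂ (7 ^ m) (4 ^ k) ⟩
  7 * (7 * 7 ^ m) * (4 * 4 ^ k)   ∎
  where
  open ≤-Reasoning
  m≤2k : m ≤ 2 * k
  m≤2k = s≤s⁻¹ (s≤s⁻¹ (≤-trans m≤2k+2 (≤-reflexive (*-distribˡ-+ 2 1 k))))
  factor₁ : ∀ x y → 3 * x * (8 * (8 * y)) ≡ 192 * (x * y)
  factor₁ = solve-∀
  factor₂ : ∀ x y → 196 * (x * y) ≡ 7 * (7 * x) * (4 * y)
  factor₂ = solve-∀

missing⇒pairsFree : (S : Vec Bool n) (p : ℕ → Bool) {d : ℕ} (m : ℕ) → T (not (hasDiff S d)) → T (pairsFree p d m S)
missing⇒pairsFree S p {d} m missing = allBelow⁺ _ m (λ x _ → no-pair x)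
  where
  no-pair : ∀ x → T (not (p x ∧ mem S x ∧ mem S (x + d)))
  no-pair x with p x ∧ mem S x ∧ mem S (x + d) in pair
  ... | false = _
  ... | true  =
    let _ , x∈S∧x+d∈S = Equivalence.to (T-∧ {p x}) (subst T (sym pair) _)
        x∈S , x+d∈S = Equivalence.to (T-∧ {mem S x}) x∈S∧x+d∈S
    in T-not⇒¬T missing (hasDiff⁺ S x∈S x+d∈S)

count-missingDiff : (d : ℕ) .{{_ : NonZero d}} → d ≤ n →
  count n (λ S → not (hasDiff S d)) * 8 ^ (n ∸ d) ≤ 7 ^ (n ∸ d) * 2 ^ n
count-missingDiff {n} d d≤n = *-cancelʳ-≤ _ _ (4 ^ k) {{m^n≢0 4 k}} (begin
  count n (λ S → not (hasDiff S d)) * 8 ^ m * 4 ^ k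
    ≤⟨ *-monoˡ-≤ (4 ^ k) (*-monoˡ-≤ (8 ^ m) (count-mono {n} (λ S → missing⇒pairsFree S firstHalf {d} m))) ⟩
  count n (pairsFree firstHalf d m) * 8 ^ m * 4 ^ k
    ≡⟨ swap (count n (pairsFree firstHalf d m)) (8 ^ m) (4 ^ k) ⟩
  count n (pairsFree firstHalf d m) * 4 ^ k * 8 ^ m
    ≡⟨ cong (_* 8 ^ m) (count-pairsFree firstHalf m (>-nonZero⁻¹ d) (≤-reflexive (m∸n+n≡m d≤n)) firstHalf-isolated) ⟩
  3 ^ k * 2 ^ n * 8 ^ m
    ≡⟨ swap (3 ^ k) (2 ^ n) (8 ^ m) ⟩
  3 ^ k * 8 ^ m * 2 ^ n
    ≤⟨ *-monoˡ-≤ (2 ^ n) (3^k*8^m≤7^m*4^k k m (firstHalf-dense m)) ⟩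
  7 ^ m * 4 ^ k * 2 ^ n
    ≡⟨ swap (7 ^ m) (4 ^ k) (2 ^ n) ⟩
  7 ^ m * 2 ^ n * 4 ^ k ∎)
  where
  open ≤-Reasoning
  open HalfBlocks d
  m = n ∸ d
  k = countBelow firstHalf m
  swap : ∀ a b c → a * b * c ≡ a * c * b
  swap = solve-∀

count-not-allBelow : (F : ℕ → Vec Bool n → Bool) (k : ℕ) →
  count n (λ S → not (allBelow (λ i → F i S) k)) ≤ sumBelow (λ i → count n (λ S → not (F i S))) k
count-not-allBelow {n} F zero    = ≤-reflexive (count-false n)
count-not-allBelow {n} F (suc k) = begin
  count n (λ S → not (allBelow (λ i → F i S) k ∧ F k S))
    ≤⟨ count-mono {n} (λ S → T-not-∧ (allBelow (λ i → F i S) k)) ⟩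
  count n (λ S → not (allBelow (λ i → F i S) k) ∨ not (F k S))
    ≤⟨ count-∨ (λ S → not (allBelow (λ i → F i S) k)) (λ S → not (F k S)) ⟩
  count n (λ S → not (allBelow (λ i → F i S) k)) + count n (λ S → not (F k S))
    ≤⟨ +-monoˡ-≤ _ (count-not-allBelow F k) ⟩
  sumBelow (λ i → count n (λ S → not (F i S))) k + count n (λ S → not (F k S))
    ≡⟨ sumBelow-last _ k ⟨
  sumBelow (λ i → count n (λ S → not (F i S))) (suc k) ∎
  where open ≤-Reasoning

sumBelow-geometric : (y : ℕ → ℕ) (Q a k : ℕ) → (∀ j → j < k → y j * 8 ^ (a + j) ≤ 7 ^ (a + j) * Q) →
  sumBelow y k * 8 ^ a ≤ 8 * (7 ^ a * Q)
sumBelow-geometric y Q a zero    _     = z≤n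
sumBelow-geometric y Q a (suc k) bound = *-cancelˡ-≤ 8 (begin
  8 * ((y 0 + rest) * 8 ^ a)                      ≡⟨ expand (y 0) rest (8 ^ a) ⟩
  8 * (y 0 * 8 ^ a) + rest * 8 ^ suc a            ≤⟨ +-mono-≤ (*-monoʳ-≤ 8 first) (sumBelow-geometric (y ∘ suc) Q (suc a) k shifted) ⟩
  8 * (7 ^ a * Q) + 8 * (7 ^ suc a * Q)           ≡⟨ collect (7 ^ a) Q ⟩
  8 * (8 * (7 ^ a * Q))                           ∎)
  where
  open ≤-Reasoning
  rest = sumBelow (y ∘ suc) k
  first : y 0 * 8 ^ a ≤ 7 ^ a * Q
  first = subst (λ e → y 0 * 8 ^ e ≤ 7 ^ e * Q) (+-identityʳ a) (bound 0 z<s)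
  shifted : ∀ j → j < k → y (suc j) * 8 ^ (suc a + j) ≤ 7 ^ (suc a + j) * Q
  shifted j j<k = subst (λ e → y (suc j) * 8 ^ e ≤ 7 ^ e * Q) (+-suc a j) (bound (suc j) (s<s j<k))
  expand : ∀ u v w → 8 * ((u + v) * w) ≡ 8 * (u * w) + v * (8 * w)
  expand = solve-∀
  collect : ∀ u q → 8 * (u * q) + 8 * ((7 * u) * q) ≡ 8 * (8 * (u * q))
  collect = solve-∀

bad-bound : (L : ℕ) → suc L ≤ n → bad L n * 8 ^ suc L ≤ 8 * (7 ^ suc L * 2 ^ n)
bad-bound {n} L 1+L≤n = begin
  bad L n * 8 ^ suc L
    ≤⟨ *-monoˡ-≤ (8 ^ suc L) (count-not-allBelow {n} (λ i S → hasDiff S (suc i)) k) ⟩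
  sumBelow (λ i → missing (suc i)) k * 8 ^ suc L
    ≡⟨ cong (_* 8 ^ suc L) (sumBelow-reverse (λ i → missing (suc i)) k) ⟨
  sumBelow (λ j → missing (suc (k ∸ suc j))) k * 8 ^ suc L
    ≤⟨ sumBelow-geometric _ (2 ^ n) (suc L) k term ⟩
  8 * (7 ^ suc L * 2 ^ n) ∎
  where
  open ≤-Reasoning
  k = n ∸ suc L
  missing : ℕ → ℕ
  missing d = count n (λ S → not (hasDiff S d))
  n≡ : ∀ {j} → j < k → n ≡ suc (k ∸ suc j) + (suc L + j)
  n≡ {j} j<k = begin-equality
    n                                         ≡⟨ m∸n+n≡m 1+L≤n ⟨
    k + suc L                                 ≡⟨ cong (_+ suc L) (m∸n+n≡m j<k) ⟨
    (k ∸ suc j) + suc j + suc L               ≡⟨ regroup (k ∸ suc j) j L ⟩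
    suc (k ∸ suc j) + (suc L + j)             ∎
    where
    regroup : ∀ t j L → t + suc j + suc L ≡ suc t + (suc L + j)
    regroup = solve-∀
  term : ∀ j → j < k → missing (suc (k ∸ suc j)) * 8 ^ (suc L + j) ≤ 7 ^ (suc L + j) * 2 ^ n
  term j j<k = subst (λ e → missing (suc (k ∸ suc j)) * 8 ^ e ≤ 7 ^ e * 2 ^ n)
    (trans (cong (_∸ suc (k ∸ suc j)) (n≡ j<k)) (m+n∸m≡n (suc (k ∸ suc j)) (suc L + j)))
    (count-missingDiff (suc (k ∸ suc j)) (≤-trans (m≤m+n _ (suc L + j)) (≤-reflexive (sym (n≡ j<k)))))

-- The approximate recursion

couplingError : ℕ → ℕ → ℕ
couplingError L n = 2 * bad L n + bad L (suc n)

recursionError : ℕ → ℕ → ℕ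
recursionError L m = (couplingError L (suc m) + 2 * couplingError L m) + 4 * couplingError L (suc m)

ℓ#-recursion-≈ : (L m : ℕ) → suc L ≤ m ∸ suc L → (K : ℤ) →
  4 * ℓ# (2 + m) K + ℓ# (2 + m) ((K ℤ.- ℤ.+ 2) ℤ.- ℤ.+ 2)
    ≈[ recursionError L m ]
  4 * j# (2 + m) K + 4 * ℓ# (2 + m) (K ℤ.- ℤ.+ 2)
ℓ#-recursion-≈ L m 1+L≤q K = ≈-trans (≈-+ˡ (4 * ℓ# (2 + m) K) shrink)
  (subst (_≈[ 4 * couplingError L (suc m) ] 4 * j# (2 + m) K + 4 * ℓ# (2 + m) K′) (sym recursion×4)
    (≈-+ˡ (4 * j# (2 + m) K) (≈-sym (≈-*ˡ 4 (coupling {suc m} L 1+L≤q′ K′)))))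
  where
  K′ K″ : ℤ
  K′ = K ℤ.- ℤ.+ 2
  K″ = K′ ℤ.- ℤ.+ 2
  1+L≤q′ : suc L ≤ suc m ∸ suc L
  1+L≤q′ = ≤-trans 1+L≤q (∸-monoˡ-≤ (suc L) (n≤1+n m))
  shrink : ℓ# (2 + m) K″ ≈[ couplingError L (suc m) + 2 * couplingError L m ] 4 * ℓ# m K″
  shrink = subst (ℓ# (2 + m) K″ ≈[ couplingError L (suc m) + 2 * couplingError L m ]_) (sym (*-assoc 2 2 (ℓ# m K″)))
    (≈-trans (coupling {suc m} L 1+L≤q′ K″) (≈-*ˡ 2 (coupling {m} L 1+L≤q K″)))
  recursion×4 : 4 * ℓ# (2 + m) K + 4 * ℓ# m K″ ≡ 4 * j# (2 + m) K + 4 * (2 * ℓ# (suc m) K′)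
  recursion×4 = begin
    4 * ℓ# (2 + m) K + 4 * ℓ# m K″               ≡⟨ *-distribˡ-+ 4 (ℓ# (2 + m) K) _ ⟨
    4 * (ℓ# (2 + m) K + ℓ# m K″)                 ≡⟨ cong (4 *_) (ℓ#-recursion m K) ⟩
    4 * (2 * ℓ# (suc m) K′ + j# (2 + m) K)       ≡⟨ *-distribˡ-+ 4 (2 * ℓ# (suc m) K′) _ ⟩
    4 * (2 * ℓ# (suc m) K′) + 4 * j# (2 + m) K   ≡⟨ +-comm (4 * (2 * ℓ# (suc m) K′)) _ ⟩
    4 * j# (2 + m) K + 4 * (2 * ℓ# (suc m) K′)   ∎
    where open ≡-Reasoning

recursion-error-bound : (L m : ℕ) → suc L ≤ m →
  recursionError L m * 8 ^ suc L ≤ 384 * (7 ^ suc L * 2 ^ m)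
recursion-error-bound L m 1+L≤m = begin
  recursionError L m * 8 ^ suc L
    ≡⟨ expand (bad L m) (bad L (suc m)) (bad L (2 + m)) (8 ^ suc L) ⟩
  4 * (bad L m * 8 ^ suc L) + 12 * (bad L (suc m) * 8 ^ suc L) + 5 * (bad L (2 + m) * 8 ^ suc L)
    ≤⟨ +-mono-≤ (+-mono-≤ (*-monoʳ-≤ 4 (bad-bound L 1+L≤m)) (*-monoʳ-≤ 12 (bad-bound L (m≤n⇒m≤1+n 1+L≤m))))
                (*-monoʳ-≤ 5 (bad-bound L (m≤n⇒m≤1+n (m≤n⇒m≤1+n 1+L≤m)))) ⟩
  4 * (8 * (7 ^ suc L * 2 ^ m)) + 12 * (8 * (7 ^ suc L * 2 ^ suc m)) + 5 * (8 * (7 ^ suc L * 2 ^ (2 + m)))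
    ≡⟨ collect (7 ^ suc L) (2 ^ m) ⟩
  384 * (7 ^ suc L * 2 ^ m) ∎
  where
  open ≤-Reasoning
  expand : ∀ x y z w → (((2 * y + z) + 2 * (2 * x + y)) + 4 * (2 * y + z)) * w ≡ 4 * (x * w) + 12 * (y * w) + 5 * (z * w)
  expand = solve-∀
  collect : ∀ s t → 4 * (8 * (s * t)) + 12 * (8 * (s * (2 * t))) + 5 * (8 * (s * (2 * (2 * t)))) ≡ 384 * (s * t)
  collect = solve-∀

residual : ℕ → ℤ → ℤ
residual m K =
  ℤ.+ (4 * ℓ# (2 + m) K + ℓ# (2 + m) ((K ℤ.- ℤ.+ 2) ℤ.- ℤ.+ 2)) ℤ.- ℤ.+ (4 * j# (2 + m) K + 4 * ℓ# (2 + m) (K ℤ.- ℤ.+ 2))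

∣residual∣-bound : (L m : ℕ) (K : ℤ) → suc L + suc L ≤ m → ℤ.∣ residual m K ∣ * 8 ^ suc L ≤ 384 * (7 ^ suc L * 2 ^ m)
∣residual∣-bound L m K 2+2L≤m =
  ≤-trans (*-monoˡ-≤ (8 ^ suc L) (≈⇒∣-∣≤ (ℓ#-recursion-≈ L m (m+n≤o⇒m≤o∸n (suc L) 2+2L≤m) K)))
          (recursion-error-bound L m (m+n≤o⇒m≤o (suc L) 2+2L≤m))

7^n*[7+n]≤7*8^n : ∀ n → 7 ^ n * (7 + n) ≤ 7 * 8 ^ n
7^n*[7+n]≤7*8^n zero    = ≤-refl
7^n*[7+n]≤7*8^n (suc n) = begin
  7 * 7 ^ n * (7 + suc n)                  ≤⟨ m≤m+n _ (7 ^ n * n) ⟩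
  7 * 7 ^ n * (7 + suc n) + 7 ^ n * n      ≡⟨ regroup (7 ^ n) n ⟩
  8 * (7 ^ n * (7 + n))                    ≤⟨ *-monoʳ-≤ 8 (7^n*[7+n]≤7*8^n n) ⟩
  8 * (7 * 8 ^ n)                          ≡⟨ swap (8 ^ n) ⟩
  7 * 8 ^ suc n                            ∎
  where
  open ≤-Reasoning
  regroup : ∀ w n → 7 * w * (7 + suc n) + w * n ≡ 8 * (w * (7 + n))
  regroup = solve-∀
  swap : ∀ x → 8 * (7 * x) ≡ 7 * (8 * x)
  swap = solve-∀

8^n-dominates-7^n : ∀ c → ∃[ L ] c * 7 ^ suc L < 8 ^ suc L
8^n-dominates-7^n c = 7 * c , *-cancelˡ-< 7 _ _ (begin-strict
  7 * (c * 7 ^ j)     ≡⟨ regroup c (7 ^ j) ⟩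
  7 ^ j * (7 * c)     <⟨ *-monoʳ-< (7 ^ j) {{m^n≢0 7 j}} (<-≤-trans (n<1+n (7 * c)) (m≤n+m j 7)) ⟩
  7 ^ j * (7 + j)     ≤⟨ 7^n*[7+n]≤7*8^n j ⟩
  7 * 8 ^ j           ∎)
  where
  open ≤-Reasoning
  j = suc (7 * c)
  regroup : ∀ c w → 7 * (c * w) ≡ w * (7 * c)
  regroup = solve-∀

numerator-bound : {z q s j t : ℕ} .{{_ : NonZero t}} → z * 8 ^ j ≤ 384 * (7 ^ j * t) → 24 * q * 7 ^ j < 8 ^ j →
  z * q < suc s * (2 * (2 * (2 * (2 * t))))
numerator-bound {z} {q} {s} {j} {t} z8ʲ≤ 24q7ʲ<8ʲ = *-cancelʳ-< (8 ^ j) _ _ (begin-strict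
  z * q * 8 ^ j                 ≡⟨ swap z q (8 ^ j) ⟩
  z * 8 ^ j * q                 ≤⟨ *-monoˡ-≤ q z8ʲ≤ ⟩
  384 * (7 ^ j * t) * q         ≡⟨ regroup (7 ^ j) t q ⟩
  16 * t * (24 * q * 7 ^ j)     <⟨ *-monoʳ-< (16 * t) {{m*n≢0 16 t}} 24q7ʲ<8ʲ ⟩
  16 * t * 8 ^ j                ≤⟨ *-monoˡ-≤ (8 ^ j) (m≤n*m (16 * t) (suc s)) ⟩
  suc s * (16 * t) * 8 ^ j      ≡⟨ cong (λ u → suc s * u * 8 ^ j) (16t≡2⁴t t) ⟩
  suc s * (2 * (2 * (2 * (2 * t)))) * 8 ^ j ∎)
  where
  open ≤-Reasoning
  swap : ∀ a b c → a * b * c ≡ a * c * b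
  swap = solve-∀
  regroup : ∀ w t q → 384 * (w * t) * q ≡ 16 * t * (24 * q * w)
  regroup = solve-∀
  16t≡2⁴t : ∀ t → 16 * t ≡ 2 * (2 * (2 * (2 * t)))
  16t≡2⁴t = solve-∀

-- Rationals

private instance
  double-nonZero : {M : ℕ} .{{_ : NonZero M}} → NonZero (2 * M)
  double-nonZero {M} = m*n≢0 2 M

ι : ℤ → ℚ
ι i = i ℚ./ 1

toℚᵘ-/ : (i : ℤ) (M : ℕ) .{{_ : NonZero M}} → toℚᵘ (i ℚ./ M) ≃ᵘ i /ᵘ M
toℚᵘ-/ i (suc t) = ℚP.toℚᵘ-fromℚᵘ (mkℚᵘ i t)

≡-via-ℚᵘ : {p q : ℚ} {P Q : ℚᵘ} → toℚᵘ p ≃ᵘ P → toℚᵘ q ≃ᵘ Q → P ≃ᵘ Q → p ≡ q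
≡-via-ℚᵘ p≃P q≃Q P≃Q = ℚP.toℚᵘ-injective (ℚᵘP.≃-trans p≃P (ℚᵘP.≃-trans P≃Q (ℚᵘP.≃-sym q≃Q)))

/-as-* : (i : ℤ) (M : ℕ) .{{_ : NonZero M}} → i ℚ./ M ≡ ι i ℚ.* (ℤ.+ 1 ℚ./ M)
/-as-* i (suc t) = ≡-via-ℚᵘ (toℚᵘ-/ i (suc t))
  (ℚᵘP.≃-trans (ℚP.toℚᵘ-homo-* (ι i) (ℤ.+ 1 ℚ./ suc t)) (ℚᵘP.*-cong (toℚᵘ-/ i 1) (toℚᵘ-/ (ℤ.+ 1) (suc t))))
  (*≡* (law i (ℤ.+ suc t)))
  where
  law : ∀ i T → i ℤ.* (ℤ.+ 1 ℤ.* T) ≡ (i ℤ.* ℤ.+ 1) ℤ.* T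
  law = ZR.solve-∀

1/M≡4*1/4M : (M : ℕ) .{{_ : NonZero M}} → ℤ.+ 1 ℚ./ M ≡ ι (ℤ.+ 4) ℚ.* (ℤ.+ 1 ℚ./ (2 * (2 * M)))
1/M≡4*1/4M (suc t) = ≡-via-ℚᵘ (toℚᵘ-/ (ℤ.+ 1) (suc t))
  (ℚᵘP.≃-trans (ℚP.toℚᵘ-homo-* (ι (ℤ.+ 4)) (ℤ.+ 1 ℚ./ (2 * (2 * suc t))))
    (ℚᵘP.*-cong (toℚᵘ-/ (ℤ.+ 4) 1) (toℚᵘ-/ (ℤ.+ 1) (2 * (2 * suc t)))))
  (*≡* (law (ℤ.+ suc t)))
  where
  law : ∀ T → ℤ.+ 1 ℤ.* (ℤ.+ 1 ℤ.* (ℤ.+ 2 ℤ.* (ℤ.+ 2 ℤ.* T))) ≡ (ℤ.+ 4 ℤ.* ℤ.+ 1) ℤ.* T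
  law = ZR.solve-∀

ι-+ : ∀ i j → ι (i ℤ.+ j) ≡ ι i ℚ.+ ι j
ι-+ i j = ≡-via-ℚᵘ (toℚᵘ-/ (i ℤ.+ j) 1)
  (ℚᵘP.≃-trans (ℚP.toℚᵘ-homo-+ (ι i) (ι j)) (ℚᵘP.+-cong (toℚᵘ-/ i 1) (toℚᵘ-/ j 1)))
  (*≡* (law i j))
  where
  law : ∀ i j → (i ℤ.+ j) ℤ.* ℤ.+ 1 ≡ (i ℤ.* ℤ.+ 1 ℤ.+ j ℤ.* ℤ.+ 1) ℤ.* ℤ.+ 1
  law = ZR.solve-∀

ι-* : ∀ i j → ι (i ℤ.* j) ≡ ι i ℚ.* ι j
ι-* i j = ≡-via-ℚᵘ (toℚᵘ-/ (i ℤ.* j) 1)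
  (ℚᵘP.≃-trans (ℚP.toℚᵘ-homo-* (ι i) (ι j)) (ℚᵘP.*-cong (toℚᵘ-/ i 1) (toℚᵘ-/ j 1)))
  (*≡* refl)

ι-neg : ∀ i → ι (ℤ.- i) ≡ ℚ.- ι i
ι-neg i = ≡-via-ℚᵘ (toℚᵘ-/ (ℤ.- i) 1)
  (ℚᵘP.≃-trans (ℚP.toℚᵘ-homo‿- (ι i)) (ℚᵘP.-‿cong (toℚᵘ-/ i 1)))
  (*≡* refl)

∣/∣< : (Z : ℤ) (M : ℕ) .{{_ : NonZero M}} (ε : ℚ) {p : ℕ} → ↥ ε ≡ ℤ.+ suc p →
  ℤ.∣ Z ∣ * ↧ₙ ε < suc p * M → ℚ.∣ Z ℚ./ M ∣ ℚ.< ε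
∣/∣< Z M@(suc _) ε@(mkℚ _ _ _) {p} ↥ε≡1+p ∣Z∣↧ε<↥εM = ℚP.toℚᵘ-cancel-<
  (ℚᵘP.<-respˡ-≃ (ℚᵘP.≃-sym (ℚᵘP.≃-trans (ℚP.toℚᵘ-homo-∣-∣ (Z ℚ./ M)) (ℚᵘP.∣-∣-cong (toℚᵘ-/ Z M))))
    (ℚᵘ.*<* (subst₂ ℤ._<_ (ℤP.pos-* ℤ.∣ Z ∣ (↧ₙ ε)) (trans (ℤP.pos-* (suc p) M) (cong (ℤ._* ℤ.+ M) (sym ↥ε≡1+p)))
      (ℤ.+<+ ∣Z∣↧ε<↥εM))))

private
  ι4 q4 : ℚ
  ι4 = ι (ℤ.+ 4)
  q4 = ℤ.+ 1 ℚ./ 4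

  module ℚ-Solver = Data.Rational.Solver.+-*-Solver

residual-ring : ∀ (A E B C r : ℚ) →
  A ℚ.* (ι4 ℚ.* r) ℚ.- (q4 ℚ.* (E ℚ.* (ι4 ℚ.* (ι4 ℚ.* r))) ℚ.+ B ℚ.* (ι4 ℚ.* r) ℚ.- q4 ℚ.* (C ℚ.* (ι4 ℚ.* r)))
    ≡ ((ι4 ℚ.* A ℚ.+ C) ℚ.- (ι4 ℚ.* E ℚ.+ ι4 ℚ.* B)) ℚ.* r
residual-ring = ℚ-Solver.solve 5 (λ A E B C r →
  A :* (con ι4 :* r) :- (con q4 :* (E :* (con ι4 :* (con ι4 :* r))) :+ B :* (con ι4 :* r) :- con q4 :* (C :* (con ι4 :* r)))
    := ((con ι4 :* A :+ C) :- (con ι4 :* E :+ con ι4 :* B)) :* r) refl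
  where open ℚ-Solver

ι-4x+y : ∀ x y → ι (ℤ.+ (4 * x + y)) ≡ ι4 ℚ.* ι (ℤ.+ x) ℚ.+ ι (ℤ.+ y)
ι-4x+y x y = begin
  ι (ℤ.+ (4 * x + y))               ≡⟨ cong ι (ℤP.pos-+ (4 * x) y) ⟩
  ι (ℤ.+ (4 * x) ℤ.+ ℤ.+ y)         ≡⟨ ι-+ (ℤ.+ (4 * x)) (ℤ.+ y) ⟩
  ι (ℤ.+ (4 * x)) ℚ.+ ι (ℤ.+ y)     ≡⟨ cong (λ z → ι z ℚ.+ ι (ℤ.+ y)) (ℤP.pos-* 4 x) ⟩
  ι (ℤ.+ 4 ℤ.* ℤ.+ x) ℚ.+ ι (ℤ.+ y) ≡⟨ cong (ℚ._+ ι (ℤ.+ y)) (ι-* (ℤ.+ 4) (ℤ.+ x)) ⟩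
  ι4 ℚ.* ι (ℤ.+ x) ℚ.+ ι (ℤ.+ y)    ∎
  where open ≡-Reasoning

-- The quantity of the theorem at n = m + 2, where t = 2ᵐ, is an integer over 2ⁿ⁺².
residual-≡ : (a e b c t : ℕ) .{{_ : NonZero t}} →
  (ℤ.+ a ℚ./ (2 * (2 * t))) ℚ.- (q4 ℚ.* (ℤ.+ e ℚ./ t) ℚ.+ (ℤ.+ b ℚ./ (2 * (2 * t))) ℚ.- q4 ℚ.* (ℤ.+ c ℚ./ (2 * (2 * t))))
    ≡ (ℤ.+ (4 * a + c) ℤ.- ℤ.+ (4 * e + 4 * b)) ℚ./ (2 * (2 * (2 * (2 * t))))
residual-≡ a e b c t = begin
  (ℤ.+ a ℚ./ N) ℚ.- (q4 ℚ.* (ℤ.+ e ℚ./ t) ℚ.+ (ℤ.+ b ℚ./ N) ℚ.- q4 ℚ.* (ℤ.+ c ℚ./ N))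
    ≡⟨ cong₂ ℚ._-_ (over-N a) (cong₂ ℚ._-_ (cong₂ ℚ._+_ (cong (q4 ℚ.*_) over-t) (over-N b)) (cong (q4 ℚ.*_) (over-N c))) ⟩
  ι (ℤ.+ a) ℚ.* (ι4 ℚ.* r) ℚ.- (q4 ℚ.* (ι (ℤ.+ e) ℚ.* (ι4 ℚ.* (ι4 ℚ.* r))) ℚ.+ ι (ℤ.+ b) ℚ.* (ι4 ℚ.* r)
    ℚ.- q4 ℚ.* (ι (ℤ.+ c) ℚ.* (ι4 ℚ.* r)))
    ≡⟨ residual-ring (ι (ℤ.+ a)) (ι (ℤ.+ e)) (ι (ℤ.+ b)) (ι (ℤ.+ c)) r ⟩
  ((ι4 ℚ.* ι (ℤ.+ a) ℚ.+ ι (ℤ.+ c)) ℚ.- (ι4 ℚ.* ι (ℤ.+ e) ℚ.+ ι4 ℚ.* ι (ℤ.+ b))) ℚ.* r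
    ≡⟨ cong (ℚ._* r) ι-Z ⟨
  ι Z ℚ.* r
    ≡⟨ /-as-* Z (2 * (2 * N)) ⟨
  Z ℚ./ (2 * (2 * N)) ∎
  where
  open ≡-Reasoning
  N = 2 * (2 * t)
  r = ℤ.+ 1 ℚ./ (2 * (2 * N))
  Z = ℤ.+ (4 * a + c) ℤ.- ℤ.+ (4 * e + 4 * b)
  over-N : ∀ x → ℤ.+ x ℚ./ N ≡ ι (ℤ.+ x) ℚ.* (ι4 ℚ.* r)
  over-N x = trans (/-as-* (ℤ.+ x) N) (cong (ι (ℤ.+ x) ℚ.*_) (1/M≡4*1/4M N))
  over-t : ℤ.+ e ℚ./ t ≡ ι (ℤ.+ e) ℚ.* (ι4 ℚ.* (ι4 ℚ.* r))
  over-t = trans (/-as-* (ℤ.+ e) t) (cong (ι (ℤ.+ e) ℚ.*_) (trans (1/M≡4*1/4M t) (cong (ι4 ℚ.*_) (1/M≡4*1/4M N))))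
  ι-Z : ι Z ≡ (ι4 ℚ.* ι (ℤ.+ a) ℚ.+ ι (ℤ.+ c)) ℚ.- (ι4 ℚ.* ι (ℤ.+ e) ℚ.+ ι4 ℚ.* ι (ℤ.+ b))
  ι-Z = begin
    ι (ℤ.+ (4 * a + c) ℤ.+ ℤ.- ℤ.+ (4 * e + 4 * b))                 ≡⟨ ι-+ (ℤ.+ (4 * a + c)) (ℤ.- ℤ.+ (4 * e + 4 * b)) ⟩
    ι (ℤ.+ (4 * a + c)) ℚ.+ ι (ℤ.- ℤ.+ (4 * e + 4 * b))             ≡⟨ cong₂ ℚ._+_ (ι-4x+y a c) (ι-neg (ℤ.+ (4 * e + 4 * b))) ⟩
    (ι4 ℚ.* ι (ℤ.+ a) ℚ.+ ι (ℤ.+ c)) ℚ.- ι (ℤ.+ (4 * e + 4 * b))    ≡⟨ cong (λ z → (ι4 ℚ.* ι (ℤ.+ a) ℚ.+ ι (ℤ.+ c)) ℚ.- z)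
                                                                            (trans (ι-4x+y e (4 * b)) (cong (ι4 ℚ.* ι (ℤ.+ e) ℚ.+_)
                                                                              (trans (cong ι (ℤP.pos-* 4 b)) (ι-* (ℤ.+ 4) (ℤ.+ b))))) ⟩
    (ι4 ℚ.* ι (ℤ.+ a) ℚ.+ ι (ℤ.+ c)) ℚ.- (ι4 ℚ.* ι (ℤ.+ e) ℚ.+ ι4 ℚ.* ι (ℤ.+ b)) ∎

positive-numerator : {ε : ℚ} → 0ℚ ℚ.< ε → ∃[ p ] ↥ ε ≡ ℤ.+ suc p
positive-numerator {mkℚ (ℤ.+ suc p) _ _} _                       = p , refl
positive-numerator {mkℚ (ℤ.+ zero)  _ _} (ℚ.*<* (ℤ.+<+ ()))
positive-numerator {mkℚ -[1+ _ ]    _ _} (ℚ.*<* ())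

ellN-≡ : (n : ℕ) (K : ℤ) → ellN n K ≡ (ℤ.+ ℓ# n K ℚ./ 2 ^ n) {{m^n≢0 2 n}}
ellN-≡ n K = ℚP./-cong {{m^n≢0 2 n}} {{m^n≢0 2 n}} (cong ℤ.+_ (length-filterᵇ (event K) (allSubsets n))) refl

-- jN with the case split of its definition exposed, so that its denominator can be rewritten.
private
  jN-by-cases : ℕ → ℤ → ℕ → ℚ
  jN-by-cases n K zero    = 0ℚ
  jN-by-cases n K (suc c) = ℤ.+ length (filterᵇ (λ S → ends S ∧ event K S) (allSubsets n)) ℚ./ suc c

  jN≡jN-by-cases : ∀ n K → jN n K ≡ jN-by-cases n K (length (filterᵇ ends (allSubsets n)))
  jN≡jN-by-cases n K with length (filterᵇ ends (allSubsets n))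
  ... | zero  = refl
  ... | suc c = refl

jN-≡ : (n c : ℕ) .{{_ : NonZero c}} (K : ℤ) → length (filterᵇ ends (allSubsets n)) ≡ c →
  jN n K ≡ ℤ.+ j# n K ℚ./ c
jN-≡ n (suc c) K ends-length = trans (jN≡jN-by-cases n K) (trans (cong (jN-by-cases n K) ends-length)
  (cong (λ i → i ℚ./ suc c) (cong ℤ.+_ (length-filterᵇ (λ S → ends S ∧ event K S) (allSubsets n)))))

ellN-jN-residual : (m : ℕ) (K : ℤ) →
  ellN (2 + m) K ℚ.- (q4 ℚ.* jN (2 + m) K ℚ.+ ellN (2 + m) (K ℤ.- ℤ.+ 2) ℚ.- q4 ℚ.* ellN (2 + m) (K ℤ.- ℤ.+ 4))
    ≡ (residual m K ℚ./ 2 ^ (4 + m)) {{m^n≢0 2 (4 + m)}}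
ellN-jN-residual m K = begin
  shape (ellN N K) (jN N K) (ellN N K′) (ellN N (K ℤ.- ℤ.+ 4))
    ≡⟨ cong (shape (ellN N K) (jN N K) (ellN N K′)) (cong (ellN N) (K-4≡K″ K)) ⟩
  shape (ellN N K) (jN N K) (ellN N K′) (ellN N K″)
    ≡⟨ cong₂ (λ x y → shape x y (ellN N K′) (ellN N K″)) (ellN-≡ N K) (jN-≡ N (2 ^ m) {{m^n≢0 2 m}} K ends-length) ⟩
  shape (fraction K) ((ℤ.+ j# N K ℚ./ 2 ^ m) {{m^n≢0 2 m}}) (ellN N K′) (ellN N K″)
    ≡⟨ cong₂ (shape (fraction K) ((ℤ.+ j# N K ℚ./ 2 ^ m) {{m^n≢0 2 m}})) (ellN-≡ N K′) (ellN-≡ N K″) ⟩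
  shape (fraction K) ((ℤ.+ j# N K ℚ./ 2 ^ m) {{m^n≢0 2 m}}) (fraction K′) (fraction K″)
    ≡⟨ residual-≡ (ℓ# N K) (j# N K) (ℓ# N K′) (ℓ# N K″) (2 ^ m) {{m^n≢0 2 m}} ⟩
  (residual m K ℚ./ 2 ^ (4 + m)) {{m^n≢0 2 (4 + m)}} ∎
  where
  open ≡-Reasoning
  N = 2 + m
  K′ K″ : ℤ
  K′ = K ℤ.- ℤ.+ 2
  K″ = K′ ℤ.- ℤ.+ 2
  shape : ℚ → ℚ → ℚ → ℚ → ℚ
  shape x y z w = x ℚ.- (q4 ℚ.* y ℚ.+ z ℚ.- q4 ℚ.* w)
  fraction : ℤ → ℚ
  fraction K = (ℤ.+ ℓ# N K ℚ./ 2 ^ N) {{m^n≢0 2 N}}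
  ends-length : length (filterᵇ ends (allSubsets N)) ≡ 2 ^ m
  ends-length = trans (length-filterᵇ ends (allSubsets N)) (ends-count m)
  K-4≡K″ : ∀ x → x ℤ.- ℤ.+ 4 ≡ (x ℤ.- ℤ.+ 2) ℤ.- ℤ.+ 2
  K-4≡K″ = ZR.solve-∀

lemma3p14 : (k : ℕ) → (ε : ℚ) → 0ℚ ℚ.< ε →
    ∃[ N ] ((n : ℕ) → N ≤ n →
    ℚ.∣ ellN n (ℤ.+ k) ℚ.- ((ℤ.+ 1 ℚ./ 4) ℚ.* jN n (ℤ.+ k) ℚ.+ ellN n (ℤ.+ k ℤ.- ℤ.+ 2) ℚ.- (ℤ.+ 1 ℚ./ 4) ℚ.* ellN n (ℤ.+ k ℤ.- ℤ.+ 4)) ∣ ℚ.< ε)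
lemma3p14 k ε 0<ε = 4 + (L + L) , λ { (suc (suc m)) (s≤s (s≤s 2+2L≤m)) →
  subst (ℚ._< ε) (cong ℚ.∣_∣ (sym (ellN-jN-residual m K)))
    (∣/∣< (residual m K) (2 ^ (4 + m)) {{m^n≢0 2 (4 + m)}} ε {p} ↥ε≡1+p
      (numerator-bound {ℤ.∣ residual m K ∣} {↧ₙ ε} {p} {suc L} {2 ^ m} {{m^n≢0 2 m}}
        (∣residual∣-bound L m K (subst (_≤ m) (cong suc (sym (+-suc L L))) 2+2L≤m))
        24↧ε7ᴸ<8ᴸ)) }
  where
  K = ℤ.+ k
  p = proj₁ (positive-numerator 0<ε)
  ↥ε≡1+p = proj₂ (positive-numerator 0<ε)
  L = proj₁ (8^n-dominates-7^n (24 * ↧ₙ ε))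
  24↧ε7ᴸ<8ᴸ = proj₂ (8^n-dominates-7^n (24 * ↧ₙ ε))
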